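{- Let $G=(V_G,E_G)$ and $H=(V_H,E_H)$ be finite simple connected graphs with $|V_G|=n$ and $|V_H|=m$. Then $$Sz(G\wr H)=n^3m^{3n-3}Sz(H)+m^n\sum_{A,B\subseteq V_G}(m-1)^{|A|+|B|}\,Sz(G,A,B).$$
   Context: The wreath product $G\wr H$ has vertex set $\{(f,v): f:V_G\to V_H,\ v\in V_G\}$; $(f,v)$ and $(f',v')$ are adjacent iff either $v=v'$, $f(w)=f'(w)$ for $w\neq v$ and $f(v)\sim f'(v)$ in $H$, or $f=f'$ and $v\sim v'$ in $G$. For a connected graph $X$ and edge $e=\{u,v\}$, $n_u(e)=|\{w\in V_X:d_X(w,u)<d_X(w,v)\}|$ and the Szeged index is $Sz(X)=\sum_{e=\{u,v\}\in E_X}n_u(e)n_v(e)$. For $A\subseteq V_G$ and $x,x'\in V_G$, $\rho_A(x,x')$ is the minimum length of a walk in $G$ from $x$ to $x'$ (vertex repetitions allowed, length $\ge0$) visiting every vertex of $A$. For $e=\{x_j,x_k\}\in E_G$, $n_{x_j}(e,\rho_A)=|\{x\in V_G:\rho_A(x,x_j)<\rho_A(x,x_k)\}|$ and symmetrically for $x_k$. For $A,B\subseteq V_G$, $Sz(G,A,B)=\sum_{e=\{x_j,x_k\}\in E_G}n_{x_j}(e,\rho_A)\,n_{x_k}(e,\rho_B)$, each edge written once with a fixed choice of which endpoint is $x_j$. The convention $0^0=1$ is used. -}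

module Defs where

open import Data.Bool using (Bool; true; false; _∧_; _∨_; if_then_else_)
open import Data.Nat using (ℕ; zero; suc; _+_; _*_; _∸_; _^_; _<?_; _≡ᵇ_)
open import Data.Fin using (Fin) renaming (_≟_ to _≟ᶠ_)
open import Data.Fin.Subset using (Subset; ∣_∣; outside)
open import Data.List using (List; []; _∷_; [_]; _++_; map; concatMap; allFin; filter; length)
open import Data.Bool.ListAction using (any; all)
open import Data.Nat.ListAction using (sum)
open import Data.Vec using (Vec; lookup; _[_]≔_) renaming ([] to []ᵥ; _∷_ to _∷ᵥ_)
import Data.Vec.Properties as VecP
import Data.Product.Properties as ProdP
open import Data.Product using (_×_; _,_; Σ)
open import Relation.Binary.PropositionalEquality using (_≡_)
open import Relation.Binary.Definitions using (DecidableEquality)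
open import Relation.Nullary.Decidable using (⌊_⌋)

-- leastBelow b p : the least i < b with p i ≡ true, and b if there is none.
leastFrom : ℕ → ℕ → (ℕ → Bool) → ℕ
leastFrom i zero    p = i
leastFrom i (suc b) p = if p i then i else leastFrom (suc i) b p

leastBelow : ℕ → (ℕ → Bool) → ℕ
leastBelow b p = leastFrom 0 b p

-- all pairs (x , y) with x occurring strictly before y in the list
-- (for a duplicate-free list: every 2-element subset exactly once)
orderedPairs : {A : Set} → List A → List (A × A)
orderedPairs []       = []
orderedPairs (x ∷ xs) = map (x ,_) xs ++ orderedPairs xs

record FinGraph : Set₁ where
  field
    V     : Set
    _≟_   : DecidableEquality V
    verts : List V
    adj   : V → V → Bool

module _ (X : FinGraph) where
  open FinGraph X

  reach : ℕ → V → V → Bool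
  reach zero    u w = ⌊ u ≟ w ⌋
  reach (suc k) u w = ⌊ u ≟ w ⌋ ∨ any (λ x → adj u x ∧ reach k x w) verts

  -- graph distance d_X(u,w) = least length of a walk from u to w
  -- (for a connected graph on N vertices this is < N)
  dist : V → V → ℕ
  dist u w = leastBelow (length verts) (λ k → reach k u w)

  nVert : V → V → ℕ
  nVert u v = length (filter (λ w → dist w u <? dist w v) verts)

  Sz : ℕ
  Sz = sum (map (λ { (u , v) → if adj u v then nVert u v * nVert v u else 0 })
                (orderedPairs verts))

record Graph (n : ℕ) : Set where
  field
    adj    : Fin n → Fin n → Bool
    sym    : ∀ u v → adj u v ≡ adj v u
    irrefl : ∀ u → adj u u ≡ false

open Graph

data Walk {n : ℕ} (G : Graph n) : Fin n → Fin n → Set where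
  here : ∀ {u} → Walk G u u
  step : ∀ {u x v} → adj G u x ≡ true → Walk G x v → Walk G u v

Connected : {n : ℕ} → Graph n → Set
Connected {n} G = ∀ (u v : Fin n) → Walk G u v

toFinGraph : {n : ℕ} → Graph n → FinGraph
toFinGraph {n} G = record
  { V = Fin n ; _≟_ = _≟ᶠ_ ; verts = allFin n ; adj = adj G }

-- Wreath product G ≀ H: vertices (f , v) with f : V_G → V_H (as a vector
-- Vec (Fin m) n, f(w) = lookup f w) and v ∈ V_G.

allVecs : (m n : ℕ) → List (Vec (Fin m) n)
allVecs m zero    = [ []ᵥ ]
allVecs m (suc n) = concatMap (λ x → map (x ∷ᵥ_) (allVecs m n)) (allFin m)

wreath : {n m : ℕ} → Graph n → Graph m → FinGraph
wreath {n} {m} G H = record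
  { V     = Vec (Fin m) n × Fin n
  ; _≟_   = ProdP.≡-dec (VecP.≡-dec _≟ᶠ_) _≟ᶠ_
  ; verts = concatMap (λ f → map (f ,_) (allFin n)) (allVecs m n)
  ; adj   = λ { (f , v) (f' , v') →
              (⌊ v ≟ᶠ v' ⌋
                ∧ all (λ w → ⌊ w ≟ᶠ v ⌋ ∨ ⌊ lookup f w ≟ᶠ lookup f' w ⌋) (allFin n)
                ∧ adj H (lookup f v) (lookup f' v))
              ∨ (⌊ VecP.≡-dec _≟ᶠ_ f f' ⌋ ∧ adj G v v') }
  }

module _ {n : ℕ} (G : Graph n) where

  removeV : Subset n → Fin n → Subset n
  removeV S x = S [ x ]≔ outside

  isEmpty : Subset n → Bool
  isEmpty S = ∣ S ∣ ≡ᵇ 0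

  covers : ℕ → Fin n → Fin n → Subset n → Bool
  covers zero    x x' S = ⌊ x ≟ᶠ x' ⌋ ∧ isEmpty (removeV S x)
  covers (suc k) x x' S =
    (⌊ x ≟ᶠ x' ⌋ ∧ isEmpty (removeV S x))
    ∨ any (λ y → adj G x y ∧ covers k y x' (removeV S x)) (allFin n)

  -- ρ_A(x,x'): minimum length of a walk from x to x' visiting all of A
  -- (in a connected graph this is ≤ (|A|+1)(n-1) < (n+1)^2)
  ρ : Subset n → Fin n → Fin n → ℕ
  ρ A x x' = leastBelow (suc n * suc n) (λ k → covers k x x' A)

  nρ : Subset n → Fin n → Fin n → ℕ
  nρ A xj xk = length (filter (λ x → ρ A x xj <? ρ A x xk) (allFin n))

  SzAB : Subset n → Subset n → ℕ
  SzAB A B = sum (map (λ { (xj , xk) → if adj G xj xk then nρ A xj xk * nρ B xk xj else 0 })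
                      (orderedPairs (allFin n)))

allSubsets : (n : ℕ) → List (Subset n)
allSubsets zero    = [ []ᵥ ]
allSubsets (suc n) = concatMap (λ b → map (b ∷ᵥ_) (allSubsets n)) (true ∷ false ∷ [])

subsetSum : {n : ℕ} → Graph n → ℕ → ℕ
subsetSum {n} G m =
  sum (map (λ A → sum (map (λ B → (m ∸ 1) ^ (∣ A ∣ + ∣ B ∣) * SzAB G A B)
                           (allSubsets n)))
           (allSubsets n))

module Submission where

-- A vertex (f , x) of G ≀ H is a lamp configuration f : V_G → V_H together with a cursor x ∈ V_G.
-- A walk from (g , x) to (f , v) must visit every base vertex w at which g and f differ, and it can
-- change lamp w only while standing there, by walking in H; conversely a shortest covering walk in G
-- with lamps switched along the way is optimal. Hence, with D(g , f) = {w | g w ≢ f w},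
--   d((g , x) , (f , v)) = ρ_{D(g , f)}(x , v) + Σ_w d_H(g w , f w).
-- For a lamp edge (f , v)(f [ v ]≔ h , v) only the term d_H(g v , _) differs; each vertex y of H stands
-- for the n m^(n-1) vertices (g , x) with g v = y, so n_{(f , v)} = n m^(n-1) n_{f v}(H). For a base edge
-- (f , v)(f , v′) the lamp terms cancel, and grouping the maps g by A = D(g , f), of which there are
-- (m - 1)^|A| each, turns n_{(f , v)} into Σ_A (m - 1)^|A| n_v(ρ_A). Summing the products over
-- ordered vertex pairs counts every edge twice, which is cancelled at the end.

open import Defs
open import Data.Nat using (ℕ; zero; suc; s≤s⁻¹; _+_; _*_; _∸_; _^_; _≤_; _<_; z≤n; s≤s; _<?_; _≡ᵇ_)
open import Data.Nat.Properties hiding (_≟_)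
open import Data.Bool using (Bool; true; false; _∧_; _∨_; not; if_then_else_)
open import Data.Bool.Properties using (∧-conicalˡ; ∧-conicalʳ; ∨-zeroʳ)
open import Data.Fin using (Fin; zero; suc; toℕ) renaming (_≟_ to _≟ᶠ_)
import Data.Fin.Properties as FinP
open import Data.Fin.Subset using (Subset; ∣_∣)
open import Data.List using (List; []; _∷_; _++_; map; concatMap; allFin; filter; length) renaming (lookup to lookupᴸ)
import Data.List.Properties as ListP
open import Data.Bool.ListAction using (any; all)
open import Data.Nat.ListAction using (sum)
open import Data.Nat.ListAction.Properties using (sum-++)
open import Data.List.Membership.Propositional using (_∈_; lose)
open import Data.List.Membership.Propositional.Properties using (∈-allFin; ∈-map⁺; ∈-concatMap⁺)
open import Data.List.Relation.Unary.Any using (here; there; index)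
open import Data.List.Relation.Unary.Any.Properties using (lookup-index)
open import Data.Vec using (Vec; lookup; _[_]≔_) renaming ([] to []ᵥ; _∷_ to _∷ᵥ_)
import Data.Vec.Properties as VecP
open import Data.Product using (_×_; _,_; ∃; proj₁; proj₂)
open import Data.Sum using (_⊎_; inj₁; inj₂)
open import Data.Empty using (⊥; ⊥-elim)
open import Function using (_∘_; flip)
open import Function.Bundles using (mk⇔)
open import Relation.Nullary using (Dec; yes; no; ¬_; does)
open import Relation.Nullary.Decidable using (⌊_⌋; isYes≗does; dec-true; dec-false; does-⇔)
open import Relation.Binary.PropositionalEquality
open import Data.Nat.Tactic.RingSolver using (solve-∀)
open import Data.Nat.Induction using (<-rec)

private
  variable
    A B : Set

∨-true⁻ : ∀ a {b} → a ∨ b ≡ true → a ≡ true ⊎ b ≡ true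
∨-true⁻ true  _ = inj₁ refl
∨-true⁻ false e = inj₂ e

false≢true : false ≢ true
false≢true ()

≢true⇒≡false : ∀ {b} → b ≢ true → b ≡ false
≢true⇒≡false {true}  ne = ⊥-elim (ne refl)
≢true⇒≡false {false} _  = refl

Bool-⇔ : ∀ {a b} → (a ≡ true → b ≡ true) → (b ≡ true → a ≡ true) → a ≡ b
Bool-⇔ {true}  {true}  _ _ = refl
Bool-⇔ {true}  {false} f _ = sym (f refl)
Bool-⇔ {false} {true}  _ g = g refl
Bool-⇔ {false} {false} _ _ = refl

module _ {p} {P : Set p} (d : Dec P) where

  ⌊⌋-true⁺ : P → ⌊ d ⌋ ≡ true
  ⌊⌋-true⁺ x = trans (isYes≗does d) (dec-true d x)

  ⌊⌋-false⁺ : ¬ P → ⌊ d ⌋ ≡ false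
  ⌊⌋-false⁺ ¬x = trans (isYes≗does d) (dec-false d ¬x)

  ⌊⌋-⇔ : ∀ {q} {Q : Set q} (e : Dec Q) → (P → Q) → (Q → P) → ⌊ d ⌋ ≡ ⌊ e ⌋
  ⌊⌋-⇔ e f g = trans (isYes≗does d) (trans (does-⇔ (mk⇔ f g) d e) (sym (isYes≗does e)))

⌊⌋-true⁻ : ∀ {p} {P : Set p} (d : Dec P) → ⌊ d ⌋ ≡ true → P
⌊⌋-true⁻ (yes x) _  = x
⌊⌋-true⁻ (no _)  ()

any-true⁻ : (p : A → Bool) (L : List A) → any p L ≡ true → ∃ λ x → x ∈ L × p x ≡ true
any-true⁻ p (x ∷ L) e with p x in eq
... | true  = x , here refl , eq
... | false with any-true⁻ p L e
... | y , y∈L , py = y , there y∈L , py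

any-true⁺ : (p : A → Bool) (L : List A) → ∀ {x} → x ∈ L → p x ≡ true → any p L ≡ true
any-true⁺ p (y ∷ L) (here refl) e rewrite e = refl
any-true⁺ p (y ∷ L) (there x∈L) e rewrite any-true⁺ p L x∈L e = ∨-zeroʳ (p y)

all-true⁻ : (p : A → Bool) (L : List A) → all p L ≡ true → ∀ {x} → x ∈ L → p x ≡ true
all-true⁻ p (y ∷ L) e (here refl) = ∧-conicalˡ (p y) _ e
all-true⁻ p (y ∷ L) e (there x∈L) = all-true⁻ p L (∧-conicalʳ (p y) _ e) x∈L

all-true⁺ : (p : A → Bool) (L : List A) → (∀ {x} → x ∈ L → p x ≡ true) → all p L ≡ true
all-true⁺ p []      _ = refl
all-true⁺ p (y ∷ L) h rewrite h (here refl) = all-true⁺ p L (h ∘ there)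

≟-suc : ∀ {k} (a b : Fin k) → ⌊ suc a ≟ᶠ suc b ⌋ ≡ ⌊ a ≟ᶠ b ⌋
≟-suc a b = ⌊⌋-⇔ (suc a ≟ᶠ suc b) (a ≟ᶠ b) FinP.suc-injective (cong suc)

𝟙 : Bool → ℕ
𝟙 b = if b then 1 else 0

𝟙-∧ : ∀ a b → 𝟙 (a ∧ b) ≡ 𝟙 a * 𝟙 b
𝟙-∧ true  b = sym (+-identityʳ (𝟙 b))
𝟙-∧ false b = refl

𝟙-∨ : ∀ a b → (a ≡ true → b ≡ true → ⊥) → 𝟙 (a ∨ b) ≡ 𝟙 a + 𝟙 b
𝟙-∨ true  true  h = ⊥-elim (h refl refl)
𝟙-∨ true  false _ = refl
𝟙-∨ false b     _ = refl

if≡𝟙* : ∀ b x → (if b then x else 0) ≡ 𝟙 b * x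
if≡𝟙* true  x = sym (+-identityʳ x)
if≡𝟙* false x = refl

∑ : List A → (A → ℕ) → ℕ
∑ L F = sum (map F L)

syntax ∑ L (λ x → e) = ∑[ x ∈ L ] e

∑-cong : (L : List A) {F G : A → ℕ} → (∀ x → F x ≡ G x) → ∑ L F ≡ ∑ L G
∑-cong L h = cong sum (ListP.map-cong h L)

∑-++ : (L K : List A) (F : A → ℕ) → ∑ (L ++ K) F ≡ ∑ L F + ∑ K F
∑-++ L K F rewrite ListP.map-++ F L K = sum-++ (map F L) (map F K)

∑-+ : (L : List A) (F G : A → ℕ) → ∑[ x ∈ L ] (F x + G x) ≡ ∑ L F + ∑ L G
∑-+ []      F G = refl
∑-+ (x ∷ L) F G rewrite ∑-+ L F G = +-exchange (F x) (G x) (∑ L F) (∑ L G)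
  where
  +-exchange : ∀ a b c d → a + b + (c + d) ≡ a + c + (b + d)
  +-exchange = solve-∀

∑-*ˡ : (L : List A) (c : ℕ) (F : A → ℕ) → ∑[ x ∈ L ] (c * F x) ≡ c * ∑ L F
∑-*ˡ []      c F = sym (*-zeroʳ c)
∑-*ˡ (x ∷ L) c F rewrite ∑-*ˡ L c F = sym (*-distribˡ-+ c (F x) (∑ L F))

∑-*ʳ : (L : List A) (c : ℕ) (F : A → ℕ) → ∑[ x ∈ L ] (F x * c) ≡ ∑ L F * c
∑-*ʳ L c F = trans (∑-cong L (λ x → *-comm (F x) c)) (trans (∑-*ˡ L c F) (*-comm c (∑ L F)))

∑-zero : (L : List A) → ∑[ _ ∈ L ] 0 ≡ 0
∑-zero []      = refl
∑-zero (_ ∷ L) = ∑-zero L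

∑-const : (L : List A) (c : ℕ) → ∑[ _ ∈ L ] c ≡ length L * c
∑-const []      c = refl
∑-const (_ ∷ L) c = cong (c +_) (∑-const L c)

∑-comm : (L : List A) (K : List B) (F : A → B → ℕ) →
         ∑[ x ∈ L ] ∑[ y ∈ K ] F x y ≡ ∑[ y ∈ K ] ∑[ x ∈ L ] F x y
∑-comm []      K F = sym (∑-zero K)
∑-comm (x ∷ L) K F rewrite ∑-comm L K F = sym (∑-+ K (F x) (λ y → ∑[ x ∈ L ] F x y))

∑-map : (L : List A) (h : A → B) (F : B → ℕ) → ∑ (map h L) F ≡ ∑ L (F ∘ h)
∑-map L h F = cong sum (sym (ListP.map-∘ L))

∑-concatMap : (L : List A) (g : A → List B) (F : B → ℕ) →
              ∑ (concatMap g L) F ≡ ∑[ x ∈ L ] ∑ (g x) F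
∑-concatMap []      g F = refl
∑-concatMap (x ∷ L) g F = trans (∑-++ (g x) (concatMap g L) F) (cong (∑ (g x) F +_) (∑-concatMap L g F))

length-filter≡∑𝟙 : {P : A → Set} (P? : ∀ x → Dec (P x)) (L : List A) →
                   length (filter P? L) ≡ ∑[ x ∈ L ] 𝟙 (does (P? x))
length-filter≡∑𝟙 P? []      = refl
length-filter≡∑𝟙 P? (x ∷ L) with P? x
... | yes _ = cong suc (length-filter≡∑𝟙 P? L)
... | no  _ = length-filter≡∑𝟙 P? L

length-allFin : ∀ n → length (allFin n) ≡ n
length-allFin n = ListP.length-tabulate {n = n} (λ i → i)

∑-allFin-suc : ∀ n (F : Fin (suc n) → ℕ) → ∑ (allFin (suc n)) F ≡ F zero + ∑ (allFin n) (F ∘ suc)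
∑-allFin-suc n F = cong (λ xs → F zero + sum xs)
  (trans (ListP.map-tabulate suc F) (sym (ListP.map-tabulate (λ i → i) (F ∘ suc))))

∑-allFin-δ : ∀ n (a : Fin n) (F : Fin n → ℕ) → ∑[ x ∈ allFin n ] (𝟙 ⌊ a ≟ᶠ x ⌋ * F x) ≡ F a
∑-allFin-δ (suc n) zero F = begin
    ∑[ x ∈ allFin (suc n) ] (𝟙 ⌊ zero ≟ᶠ x ⌋ * F x) ≡⟨ ∑-allFin-suc n _ ⟩
    F zero + 0 + ∑[ _ ∈ allFin n ] 0               ≡⟨ cong (F zero + 0 +_) (∑-zero (allFin n)) ⟩
    F zero + 0 + 0                                  ≡⟨ trans (+-identityʳ _) (+-identityʳ _) ⟩
    F zero ∎
  where open ≡-Reasoning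
∑-allFin-δ (suc n) (suc a) F = begin
    ∑[ x ∈ allFin (suc n) ] (𝟙 ⌊ suc a ≟ᶠ x ⌋ * F x)
      ≡⟨ ∑-allFin-suc n (λ x → 𝟙 ⌊ suc a ≟ᶠ x ⌋ * F x) ⟩
    ∑[ x ∈ allFin n ] (𝟙 ⌊ suc a ≟ᶠ suc x ⌋ * F (suc x))
      ≡⟨ ∑-cong (allFin n) (λ x → cong (λ b → 𝟙 b * F (suc x)) (≟-suc a x)) ⟩
    ∑[ x ∈ allFin n ] (𝟙 ⌊ a ≟ᶠ x ⌋ * F (suc x))
      ≡⟨ ∑-allFin-δ n a (F ∘ suc) ⟩
    F (suc a) ∎
  where open ≡-Reasoning

∑-orderedPairs : {A : Set} (L : List A) (T : A → A → ℕ) → (∀ x → T x x ≡ 0) →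
  ∑[ u ∈ L ] ∑[ v ∈ L ] T u v ≡ ∑[ p ∈ orderedPairs L ] (T (proj₁ p) (proj₂ p) + T (proj₂ p) (proj₁ p))
∑-orderedPairs []      T _    = refl
∑-orderedPairs {A} (x ∷ L) T diag = begin
    T x x + ∑ L (T x) + ∑[ u ∈ L ] (T u x + ∑ L (T u))
      ≡⟨ cong₂ _+_ (cong (_+ ∑ L (T x)) (diag x)) (∑-+ L (λ u → T u x) (λ u → ∑ L (T u))) ⟩
    ∑ L (T x) + (∑[ u ∈ L ] T u x + ∑[ u ∈ L ] ∑ L (T u))
      ≡⟨ sym (+-assoc (∑ L (T x)) _ _) ⟩
    ∑ L (T x) + ∑[ u ∈ L ] T u x + ∑[ u ∈ L ] ∑ L (T u)
      ≡⟨ cong₂ _+_ (sym (∑-+ L (T x) (λ u → T u x))) (∑-orderedPairs L T diag) ⟩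
    ∑[ v ∈ L ] (T x v + T v x) + ∑ (orderedPairs L) F
      ≡⟨ cong (_+ ∑ (orderedPairs L) F) (sym (∑-map L (x ,_) F)) ⟩
    ∑ (map (x ,_) L) F + ∑ (orderedPairs L) F
      ≡⟨ sym (∑-++ (map (x ,_) L) (orderedPairs L) F) ⟩
    ∑ (map (x ,_) L ++ orderedPairs L) F ∎
  where
  open ≡-Reasoning
  F : A × A → ℕ
  F p = T (proj₁ p) (proj₂ p) + T (proj₂ p) (proj₁ p)

∑-product : (L : List A) (K : List B) (F : A → ℕ) (G : B → ℕ) → ∑ L F * ∑ K G ≡ ∑[ x ∈ L ] ∑[ y ∈ K ] (F x * G y)
∑-product L K F G = sym (trans (∑-cong L (λ x → ∑-*ˡ K (F x) G)) (∑-*ʳ L (∑ K G) F))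

edgeSum : List A → (A → A → Bool) → (A → A → ℕ) → ℕ
edgeSum L adj W = ∑[ p ∈ orderedPairs L ] (if adj (proj₁ p) (proj₂ p) then W (proj₁ p) (proj₂ p) else 0)

∑∑-adj : {A : Set} (L : List A) (adj : A → A → Bool) → (∀ u v → adj u v ≡ adj v u) → (∀ u → adj u u ≡ false) →
  ∀ W → ∑[ u ∈ L ] ∑[ v ∈ L ] (𝟙 (adj u v) * W u v) ≡ edgeSum L adj W + edgeSum L adj (flip W)
∑∑-adj {A} L adj adj-sym adj-irrefl W = begin
    ∑[ u ∈ L ] ∑[ v ∈ L ] T u v
      ≡⟨ ∑-orderedPairs L T (λ x → cong (λ b → 𝟙 b * W x x) (adj-irrefl x)) ⟩
    ∑[ p ∈ Ps ] (T (proj₁ p) (proj₂ p) + T (proj₂ p) (proj₁ p))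
      ≡⟨ ∑-+ Ps _ _ ⟩
    ∑[ p ∈ Ps ] T (proj₁ p) (proj₂ p) + ∑[ p ∈ Ps ] T (proj₂ p) (proj₁ p)
      ≡⟨ cong₂ _+_ (∑-cong Ps (λ (u , v) → sym (if≡𝟙* (adj u v) _)))
                   (∑-cong Ps (λ (u , v) → trans (cong (λ b → 𝟙 b * W v u) (adj-sym v u)) (sym (if≡𝟙* (adj u v) _)))) ⟩
    edgeSum L adj W + edgeSum L adj (flip W) ∎
  where
  open ≡-Reasoning
  Ps : List (A × A)
  Ps = orderedPairs L
  T : A → A → ℕ
  T u v = 𝟙 (adj u v) * W u v

module _ (X : FinGraph) where
  open FinGraph X

  Sz-double : (∀ u v → adj u v ≡ adj v u) → (∀ u → adj u u ≡ false) →
    2 * Sz X ≡ ∑[ u ∈ verts ] ∑[ v ∈ verts ] (𝟙 (adj u v) * (nVert X u v * nVert X v u))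
  Sz-double adj-sym adj-irrefl = begin
      2 * Sz X                                 ≡⟨ cong (2 *_) Sz≡edgeSum ⟩
      2 * edgeSum verts adj N                  ≡⟨ cong (edgeSum verts adj N +_) (trans (+-identityʳ _) N-flip) ⟩
      edgeSum verts adj N + edgeSum verts adj (flip N)  ≡⟨ sym (∑∑-adj verts adj adj-sym adj-irrefl N) ⟩
      ∑[ u ∈ verts ] ∑[ v ∈ verts ] (𝟙 (adj u v) * N u v) ∎
    where
    open ≡-Reasoning
    Ps : List (V × V)
    Ps = orderedPairs verts
    N : V → V → ℕ
    N u v = nVert X u v * nVert X v u
    Sz≡edgeSum : Sz X ≡ edgeSum verts adj N
    Sz≡edgeSum = ∑-cong Ps (λ (u , v) → refl)
    N-flip : edgeSum verts adj N ≡ edgeSum verts adj (flip N)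
    N-flip = ∑-cong Ps (λ (u , v) → cong (if adj u v then_else 0) (*-comm (nVert X u v) _))

leastFrom-≤ : ∀ i b (p : ℕ → Bool) {k} → i ≤ k → p k ≡ true → leastFrom i b p ≤ k
leastFrom-≤ i zero    p i≤k _  = i≤k
leastFrom-≤ i (suc b) p {k} i≤k pk with p i in eq
... | true  = i≤k
... | false = leastFrom-≤ (suc i) b p (≤∧≢⇒< i≤k i≢k) pk
  where
  i≢k : i ≢ k
  i≢k refl = false≢true (trans (sym eq) pk)

leastFrom-satisfies : ∀ i b (p : ℕ → Bool) {k} → i ≤ k → k < i + b → p k ≡ true → p (leastFrom i b p) ≡ true
leastFrom-satisfies i zero    p i≤k k<i+0 _ = ⊥-elim (<⇒≱ (subst (_ <_) (+-identityʳ i) k<i+0) i≤k)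
leastFrom-satisfies i (suc b) p {k} i≤k k<i+b pk with p i in eq
... | true  = eq
... | false = leastFrom-satisfies (suc i) b p (≤∧≢⇒< i≤k i≢k) (subst (k <_) (+-suc i b) k<i+b) pk
  where
  i≢k : i ≢ k
  i≢k refl = false≢true (trans (sym eq) pk)

leastBelow-≤ : ∀ b (p : ℕ → Bool) {k} → p k ≡ true → leastBelow b p ≤ k
leastBelow-≤ b p = leastFrom-≤ 0 b p z≤n

leastBelow-satisfies : ∀ b (p : ℕ → Bool) {k} → k < b → p k ≡ true → p (leastBelow b p) ≡ true
leastBelow-satisfies b p = leastFrom-satisfies 0 b p z≤n

module Walks (X : FinGraph) where
  open FinGraph X

  data LWalk : V → V → ℕ → Set where
    nil  : ∀ {u} → LWalk u u 0
    cons : ∀ {u x w k} → adj u x ≡ true → LWalk x w k → LWalk u w (suc k)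

  _++ʷ_ : ∀ {u v w k l} → LWalk u v k → LWalk v w l → LWalk u w (k + l)
  nil      ++ʷ W = W
  cons e U ++ʷ W = cons e (U ++ʷ W)

  reach⇒walk : ∀ k u w → reach X k u w ≡ true → ∃ λ j → j ≤ k × LWalk u w j
  reach⇒walk zero u w e with ⌊⌋-true⁻ (u ≟ w) e
  ... | refl = 0 , z≤n , nil
  reach⇒walk (suc k) u w e with ∨-true⁻ ⌊ u ≟ w ⌋ e
  ... | inj₁ u≡w with ⌊⌋-true⁻ (u ≟ w) u≡w
  ... | refl = 0 , z≤n , nil
  reach⇒walk (suc k) u w e | inj₂ viaNeighbour with any-true⁻ _ verts viaNeighbour
  ... | x , _ , q with reach⇒walk k x w (∧-conicalʳ (adj u x) _ q)
  ... | j , j≤k , W = suc j , s≤s j≤k , cons (∧-conicalˡ (adj u x) _ q) W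

  module _ (complete : ∀ v → v ∈ verts) where

    walk⇒reach : ∀ {u w j} → LWalk u w j → ∀ k → j ≤ k → reach X k u w ≡ true
    walk⇒reach {u} nil zero    _ = ⌊⌋-true⁺ (u ≟ u) refl
    walk⇒reach {u} nil (suc k) _ rewrite ⌊⌋-true⁺ (u ≟ u) refl = refl
    walk⇒reach {u} {w} (cons {x = x} e W) (suc k) (s≤s j≤k)
      rewrite any-true⁺ (λ y → adj u y ∧ reach X k y w) verts (complete x)
                (subst (λ b → b ∧ reach X k x w ≡ true) (sym e) (walk⇒reach W k j≤k))
      = ∨-zeroʳ ⌊ u ≟ w ⌋

    vertexAt : ∀ {u w k} → LWalk u w k → ℕ → V
    vertexAt {u} nil        _       = u
    vertexAt {u} (cons _ W) zero    = u
    vertexAt     (cons _ W) (suc i) = vertexAt W i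

    takeWalk : ∀ {u w k} (W : LWalk u w k) i → i ≤ k → LWalk u (vertexAt W i) i
    takeWalk nil        zero    _       = nil
    takeWalk (cons e W) zero    _       = nil
    takeWalk (cons e W) (suc i) (s≤s p) = cons e (takeWalk W i p)

    dropWalk : ∀ {u w k} (W : LWalk u w k) i → i ≤ k → LWalk (vertexAt W i) w (k ∸ i)
    dropWalk nil        zero    _       = nil
    dropWalk (cons e W) zero    _       = cons e W
    dropWalk (cons e W) (suc i) (s≤s p) = dropWalk W i p

    N : ℕ
    N = length verts

    index-injective : ∀ {a b} → index (complete a) ≡ index (complete b) → a ≡ b
    index-injective {a} {b} e = trans (lookup-index (complete a))
      (trans (cong (lookupᴸ verts) e) (sym (lookup-index (complete b))))

    -- A walk with at least N steps visits some vertex twice; cut out the closed part.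
    shortcut : ∀ {u w k} → LWalk u w k → N ≤ k → ∃ λ j → j < k × LWalk u w j
    shortcut {u} {w} {k} W N≤k
      with FinP.pigeonhole (s≤s N≤k) (λ (i : Fin (suc k)) → index (complete (vertexAt W (toℕ i))))
    ... | i , j , i<j , same = toℕ i + (k ∸ toℕ j) , shorter , takeWalk W (toℕ i) i≤k ++ʷ loopFree
      where
      j≤k : toℕ j ≤ k
      j≤k = s≤s⁻¹ (FinP.toℕ<n j)
      i≤k : toℕ i ≤ k
      i≤k = ≤-trans (<⇒≤ i<j) j≤k
      loopFree : LWalk (vertexAt W (toℕ i)) w (k ∸ toℕ j)
      loopFree = subst (λ z → LWalk z w (k ∸ toℕ j)) (sym (index-injective same)) (dropWalk W (toℕ j) j≤k)
      shorter : toℕ i + (k ∸ toℕ j) < k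
      shorter = begin-strict
          toℕ i + (k ∸ toℕ j) <⟨ +-monoˡ-< (k ∸ toℕ j) i<j ⟩
          toℕ j + (k ∸ toℕ j) ≡⟨ m+[n∸m]≡n j≤k ⟩
          k ∎
        where open ≤-Reasoning

    shortWalk : ∀ {u w k} → LWalk u w k → ∃ λ j → j < N × LWalk u w j
    shortWalk {u} {w} {k} = <-rec (λ k → LWalk u w k → ∃ λ j → j < N × LWalk u w j) shorten k
      where
      shorten : ∀ k → (∀ {j} → j < k → LWalk u w j → ∃ λ i → i < N × LWalk u w i) →
                LWalk u w k → ∃ λ j → j < N × LWalk u w j
      shorten k rec W with k <? N
      ... | yes k<N = k , k<N , W
      ... | no  k≮N with shortcut W (≮⇒≥ k≮N)
      ... | j , j<k , W′ = rec j<k W′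

    dist-≤ : ∀ {u w k} → LWalk u w k → dist X u w ≤ k
    dist-≤ {u} {w} {k} W = leastBelow-≤ N _ (walk⇒reach W k ≤-refl)

    walk-dist : ∀ {u w k} → LWalk u w k → LWalk u w (dist X u w)
    walk-dist {u} {w} W with shortWalk W
    ... | j , j<N , W′ with reach⇒walk (dist X u w) u w
                              (leastBelow-satisfies N (λ k → reach X k u w) j<N (walk⇒reach W′ j ≤-refl))
    ... | i , i≤d , Wᵢ = subst (LWalk u w) (≤-antisym i≤d (dist-≤ Wᵢ)) Wᵢ

Walk⇒LWalk : ∀ {n} (G : Graph n) {u v} → Walk G u v → ∃ (Walks.LWalk (toFinGraph G) u v)
Walk⇒LWalk G here       = 0 , Walks.nil
Walk⇒LWalk G (step e W) with Walk⇒LWalk G W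
... | k , W′ = suc k , Walks.cons e W′

isEmpty-true⁻ : ∀ {n} (S : Subset n) → (∣ S ∣ ≡ᵇ 0) ≡ true → ∀ i → lookup S i ≡ false
isEmpty-true⁻ (false ∷ᵥ S) e zero    = refl
isEmpty-true⁻ (false ∷ᵥ S) e (suc i) = isEmpty-true⁻ S e i

isEmpty-true⁺ : ∀ {n} (S : Subset n) → (∀ i → lookup S i ≡ false) → (∣ S ∣ ≡ᵇ 0) ≡ true
isEmpty-true⁺ []ᵥ          _ = refl
isEmpty-true⁺ (true ∷ᵥ S)  h = ⊥-elim (false≢true (sym (h zero)))
isEmpty-true⁺ (false ∷ᵥ S) h = isEmpty-true⁺ S (h ∘ suc)

module CoveringWalks {n : ℕ} (G : Graph n) where
  open Walks (toFinGraph G) using (LWalk; nil; cons)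

  _∖_ : Subset n → Fin n → Subset n
  S ∖ x = removeV G S x

  lookup-∖-self : ∀ S x → lookup (S ∖ x) x ≡ false
  lookup-∖-self S x = VecP.lookup∘update x S false

  lookup-∖-other : ∀ S {x i} → i ≢ x → lookup (S ∖ x) i ≡ lookup S i
  lookup-∖-other S i≢x = VecP.lookup∘update′ i≢x S false

  ∖-true⁻ : ∀ S x i → lookup (S ∖ x) i ≡ true → lookup S i ≡ true × i ≢ x
  ∖-true⁻ S x i e with i ≟ᶠ x
  ... | yes refl = ⊥-elim (false≢true (trans (sym (lookup-∖-self S x)) e))
  ... | no  i≢x  = trans (sym (lookup-∖-other S i≢x)) e , i≢x

  -- Inductive form of covers; k is only an upper bound on the length.
  data Covering : ℕ → Fin n → Fin n → Subset n → Set where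
    stop : ∀ {k x S} → isEmpty G (S ∖ x) ≡ true → Covering k x x S
    go   : ∀ {k x y x′ S} → Graph.adj G x y ≡ true → Covering k y x′ (S ∖ x) → Covering (suc k) x x′ S

  covers⇒Covering : ∀ k x x′ S → covers G k x x′ S ≡ true → Covering k x x′ S
  covers⇒Covering zero x x′ S e with ⌊⌋-true⁻ (x ≟ᶠ x′) (∧-conicalˡ _ _ e)
  ... | refl = stop (∧-conicalʳ _ _ e)
  covers⇒Covering (suc k) x x′ S e with ∨-true⁻ (⌊ x ≟ᶠ x′ ⌋ ∧ isEmpty G (S ∖ x)) e
  ... | inj₁ here′ with ⌊⌋-true⁻ (x ≟ᶠ x′) (∧-conicalˡ _ _ here′)
  ... | refl = stop (∧-conicalʳ _ _ here′)
  covers⇒Covering (suc k) x x′ S e | inj₂ onward with any-true⁻ _ (allFin n) onward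
  ... | y , _ , q = go (∧-conicalˡ (Graph.adj G x y) _ q) (covers⇒Covering k y x′ (S ∖ x) (∧-conicalʳ (Graph.adj G x y) _ q))

  Covering⇒covers : ∀ {k x x′ S} → Covering k x x′ S → covers G k x x′ S ≡ true
  Covering⇒covers {zero}  {x} (stop e) rewrite ⌊⌋-true⁺ (x ≟ᶠ x) refl = e
  Covering⇒covers {suc k} {x} (stop e) rewrite ⌊⌋-true⁺ (x ≟ᶠ x) refl | e = refl
  Covering⇒covers {suc k} {x} {x′} {S} (go {y = y} e C)
    rewrite any-true⁺ (λ z → Graph.adj G x z ∧ covers G k z x′ (S ∖ x)) (allFin n) (∈-allFin y)
              (subst (λ b → b ∧ covers G k y x′ (S ∖ x) ≡ true) (sym e) (Covering⇒covers C))
    = ∨-zeroʳ _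

  _⊆_∪⟨_,_⟩ : Subset n → Subset n → Fin n → Fin n → Set
  S ⊆ T ∪⟨ x , x′ ⟩ = ∀ i → lookup S i ≡ true → lookup T i ≡ true ⊎ i ≡ x ⊎ i ≡ x′

  Covering-⊆ : ∀ {k x x′ S T} → Covering k x x′ T → S ⊆ T ∪⟨ x , x′ ⟩ → Covering k x x′ S
  Covering-⊆ {x = x} {S = S} {T} (stop e) S⊆T = stop (isEmpty-true⁺ (S ∖ x) rest-empty)
    where
    rest-empty : ∀ i → lookup (S ∖ x) i ≡ false
    rest-empty i with lookup (S ∖ x) i in eq
    ... | false = refl
    ... | true with ∖-true⁻ S x i eq
    ... | Sᵢ , i≢x with S⊆T i Sᵢ
    ... | inj₁ Tᵢ        = ⊥-elim (false≢true (trans (sym (isEmpty-true⁻ (T ∖ x) e i)) (trans (lookup-∖-other T i≢x) Tᵢ)))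
    ... | inj₂ (inj₁ i≡x) = ⊥-elim (i≢x i≡x)
    ... | inj₂ (inj₂ i≡x) = ⊥-elim (i≢x i≡x)
  Covering-⊆ {x = x} {x′} {S} {T} (go {y = y} e C) S⊆T = go e (Covering-⊆ C S∖x⊆T∖x)
    where
    S∖x⊆T∖x : (S ∖ x) ⊆ (T ∖ x) ∪⟨ y , x′ ⟩
    S∖x⊆T∖x i e′ with ∖-true⁻ S x i e′
    ... | Sᵢ , i≢x with S⊆T i Sᵢ
    ... | inj₁ Tᵢ         = inj₁ (trans (lookup-∖-other T i≢x) Tᵢ)
    ... | inj₂ (inj₁ i≡x)  = ⊥-elim (i≢x i≡x)
    ... | inj₂ (inj₂ i≡x′) = inj₂ (inj₂ i≡x′)

  Covering-≤ : ∀ {k k′ x x′ S} → Covering k x x′ S → k ≤ k′ → Covering k′ x x′ S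
  Covering-≤ (stop e) _         = stop e
  Covering-≤ (go e C) (s≤s k≤k′) = go e (Covering-≤ C k≤k′)

  walk++Covering : ∀ {x y x′ k k′ S R} → LWalk x y k → Covering k′ y x′ R →
                   (∀ i → lookup S i ≡ true → lookup R i ≡ true) → Covering (k + k′) x x′ S
  walk++Covering nil C S⊆R = Covering-⊆ C (λ i Sᵢ → inj₁ (S⊆R i Sᵢ))
  walk++Covering {x} {S = S} (cons e W) C S⊆R = go e (walk++Covering W C (λ i e′ → S⊆R i (proj₁ (∖-true⁻ S x i e′))))

  ρ-≤ : ∀ {k S x x′} → Covering k x x′ S → ρ G S x x′ ≤ k
  ρ-≤ C = leastBelow-≤ (suc n * suc n) _ (Covering⇒covers C)

  module _ (connected : Connected G) where

    shortWalk : ∀ u v → ∃ λ j → j < n × LWalk u v j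
    shortWalk u v with Walks.shortWalk (toFinGraph G) ∈-allFin (proj₂ (Walk⇒LWalk G (connected u v)))
    ... | j , j<N , W = j , subst (j <_) (length-allFin n) j<N , W

    -- Visit the vertices of L in order, then go to x′.
    tour : (L : List (Fin n)) → ∀ x x′ S → (∀ i → lookup S i ≡ true → i ∈ L) → Covering (length L * n + n) x x′ S
    tour [] x x′ S S⊆[] with shortWalk x x′
    ... | j , j<n , W = Covering-≤ (walk++Covering {R = S} W (stop (isEmpty-true⁺ (S ∖ x′) rest-empty)) (λ _ Sᵢ → Sᵢ))
                                   (≤-trans (≤-reflexive (+-identityʳ j)) (<⇒≤ j<n))
      where
      rest-empty : ∀ i → lookup (S ∖ x′) i ≡ false
      rest-empty i with lookup (S ∖ x′) i in eq
      ... | false = refl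
      ... | true with S⊆[] i (proj₁ (∖-true⁻ S x′ i eq))
      ... | ()
    tour (y ∷ L) x x′ S S⊆y∷L with shortWalk x y
    ... | j , j<n , W = Covering-≤ (walk++Covering {R = S} W (Covering-⊆ (tour L y x′ (S ∖ y) S∖y⊆L) S⊆S∖y) (λ _ Sᵢ → Sᵢ))
                                   (≤-trans (+-monoˡ-≤ _ (<⇒≤ j<n)) (≤-reflexive (sym (+-assoc n (length L * n) n))))
      where
      S∖y⊆L : ∀ i → lookup (S ∖ y) i ≡ true → i ∈ L
      S∖y⊆L i e with ∖-true⁻ S y i e
      ... | Sᵢ , i≢y with S⊆y∷L i Sᵢ
      ... | here i≡y = ⊥-elim (i≢y i≡y)
      ... | there i∈L = i∈L
      S⊆S∖y : S ⊆ (S ∖ y) ∪⟨ y , x′ ⟩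
      S⊆S∖y i Sᵢ with i ≟ᶠ y
      ... | yes i≡y = inj₂ (inj₁ i≡y)
      ... | no  i≢y = inj₁ (trans (lookup-∖-other S i≢y) Sᵢ)

    ρ-covering : ∀ S x x′ → Covering (ρ G S x x′) x x′ S
    ρ-covering S x x′ = covers⇒Covering _ x x′ S
      (leastBelow-satisfies (suc n * suc n) (λ k → covers G k x x′ S) bound (Covering⇒covers fullTour))
      where
      fullTour : Covering (n * n + n) x x′ S
      fullTour = subst (λ l → Covering (l * n + n) x x′ S) (length-allFin n) (tour (allFin n) x x′ S (λ i _ → ∈-allFin i))
      bound : n * n + n < suc n * suc n
      bound = s≤s (≤-trans (≤-reflexive (trans (+-comm (n * n) n) (sym (*-suc n n)))) (m≤n+m (n * suc n) n))

    ρ-cong : ∀ {S T x x′} → S ⊆ T ∪⟨ x , x′ ⟩ → T ⊆ S ∪⟨ x , x′ ⟩ → ρ G S x x′ ≡ ρ G T x x′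
    ρ-cong {S} {T} {x} {x′} S⊆T T⊆S =
      ≤-antisym (ρ-≤ (Covering-⊆ (ρ-covering T x x′) S⊆T)) (ρ-≤ (Covering-⊆ (ρ-covering S x x′) T⊆S))

module _ {m : ℕ} where

  _≟ᵛ_ : ∀ {k} (f g : Vec (Fin m) k) → Dec (f ≡ g)
  _≟ᵛ_ = VecP.≡-dec _≟ᶠ_

  ≟ᵛ-∷ : ∀ {k} (a b : Fin m) (f g : Vec (Fin m) k) → ⌊ (a ∷ᵥ f) ≟ᵛ (b ∷ᵥ g) ⌋ ≡ ⌊ a ≟ᶠ b ⌋ ∧ ⌊ f ≟ᵛ g ⌋
  ≟ᵛ-∷ a b f g with a ≟ᶠ b | f ≟ᵛ g
  ... | yes _ | yes _ = refl
  ... | yes _ | no  _ = refl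
  ... | no  _ | _     = refl

  lookup-ext : ∀ {k} (f g : Vec (Fin m) k) → (∀ i → lookup f i ≡ lookup g i) → f ≡ g
  lookup-ext f g h = trans (sym (VecP.tabulate∘lookup f)) (trans (VecP.tabulate-cong h) (VecP.tabulate∘lookup g))

  AgreeExcept : ∀ {k} → Fin k → Vec (Fin m) k → Vec (Fin m) k → Set
  AgreeExcept v f g = ∀ w → w ≢ v → lookup f w ≡ lookup g w

  agreeExcept? : ∀ {k} → Fin k → Vec (Fin m) k → Vec (Fin m) k → Bool
  agreeExcept? zero    (a ∷ᵥ f) (b ∷ᵥ g) = ⌊ f ≟ᵛ g ⌋
  agreeExcept? (suc v) (a ∷ᵥ f) (b ∷ᵥ g) = ⌊ a ≟ᶠ b ⌋ ∧ agreeExcept? v f g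

  agreeExcept?-true⁻ : ∀ {k} (v : Fin k) f g → agreeExcept? v f g ≡ true → AgreeExcept v f g
  agreeExcept?-true⁻ zero    (a ∷ᵥ f) (b ∷ᵥ g) e zero    w≢v = ⊥-elim (w≢v refl)
  agreeExcept?-true⁻ zero    (a ∷ᵥ f) (b ∷ᵥ g) e (suc w) _   = cong (λ h → lookup h w) (⌊⌋-true⁻ (f ≟ᵛ g) e)
  agreeExcept?-true⁻ (suc v) (a ∷ᵥ f) (b ∷ᵥ g) e zero    _   = ⌊⌋-true⁻ (a ≟ᶠ b) (∧-conicalˡ _ (agreeExcept? v f g) e)
  agreeExcept?-true⁻ (suc v) (a ∷ᵥ f) (b ∷ᵥ g) e (suc w) w≢v =
    agreeExcept?-true⁻ v f g (∧-conicalʳ ⌊ a ≟ᶠ b ⌋ _ e) w (w≢v ∘ cong suc)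

  agreeExcept?-true⁺ : ∀ {k} (v : Fin k) f g → AgreeExcept v f g → agreeExcept? v f g ≡ true
  agreeExcept?-true⁺ zero    (a ∷ᵥ f) (b ∷ᵥ g) h = ⌊⌋-true⁺ (f ≟ᵛ g) (lookup-ext f g (λ w → h (suc w) (λ ())))
  agreeExcept?-true⁺ (suc v) (a ∷ᵥ f) (b ∷ᵥ g) h rewrite ⌊⌋-true⁺ (a ≟ᶠ b) (h zero (λ ())) =
    agreeExcept?-true⁺ v f g (λ w w≢v → h (suc w) (w≢v ∘ FinP.suc-injective))

  AgreeExcept-update : ∀ {k} (g : Vec (Fin m) k) i c → AgreeExcept i g (g [ i ]≔ c)
  AgreeExcept-update g i c w w≢i = sym (VecP.lookup∘update′ w≢i g c)

  update-AgreeExcept : ∀ {k} (g f : Vec (Fin m) k) y → AgreeExcept y g f → g [ y ]≔ lookup f y ≡ f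
  update-AgreeExcept g f y g≈f = lookup-ext _ f updatedAt
    where
    updatedAt : ∀ i → lookup (g [ y ]≔ lookup f y) i ≡ lookup f i
    updatedAt i with i ≟ᶠ y
    ... | yes refl = VecP.lookup∘update i g (lookup f i)
    ... | no  i≢y  = trans (VecP.lookup∘update′ i≢y g _) (g≈f i i≢y)

  differ : ∀ {k} → Vec (Fin m) k → Vec (Fin m) k → Subset k
  differ []ᵥ       []ᵥ       = []ᵥ
  differ (a ∷ᵥ g) (b ∷ᵥ f) = not ⌊ a ≟ᶠ b ⌋ ∷ᵥ differ g f

  lookup-differ : ∀ {k} (g f : Vec (Fin m) k) i → lookup (differ g f) i ≡ not ⌊ lookup g i ≟ᶠ lookup f i ⌋
  lookup-differ (a ∷ᵥ g) (b ∷ᵥ f) zero    = refl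
  lookup-differ (a ∷ᵥ g) (b ∷ᵥ f) (suc i) = lookup-differ g f i

  differ-true⁻ : ∀ {k} (g f : Vec (Fin m) k) i → lookup (differ g f) i ≡ true → lookup g i ≢ lookup f i
  differ-true⁻ g f i e gᵢ≡fᵢ = false≢true (trans (cong not (sym (⌊⌋-true⁺ (lookup g i ≟ᶠ lookup f i) gᵢ≡fᵢ)))
                                                 (trans (sym (lookup-differ g f i)) e))

  differ-true⁺ : ∀ {k} (g f : Vec (Fin m) k) i → lookup g i ≢ lookup f i → lookup (differ g f) i ≡ true
  differ-true⁺ g f i gᵢ≢fᵢ = trans (lookup-differ g f i) (cong not (⌊⌋-false⁺ (lookup g i ≟ᶠ lookup f i) gᵢ≢fᵢ))

  differ-false⁺ : ∀ {k} (g f : Vec (Fin m) k) i → lookup g i ≡ lookup f i → lookup (differ g f) i ≡ false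
  differ-false⁺ g f i gᵢ≡fᵢ = trans (lookup-differ g f i) (cong not (⌊⌋-true⁺ (lookup g i ≟ᶠ lookup f i) gᵢ≡fᵢ))

  differ-false⁻ : ∀ {k} (g f : Vec (Fin m) k) i → lookup (differ g f) i ≢ true → lookup g i ≡ lookup f i
  differ-false⁻ g f i ne with lookup g i ≟ᶠ lookup f i
  ... | yes gᵢ≡fᵢ = gᵢ≡fᵢ
  ... | no  gᵢ≢fᵢ = ⊥-elim (ne (differ-true⁺ g f i gᵢ≢fᵢ))

∑-allVecs-suc : ∀ m k (F : Vec (Fin m) (suc k) → ℕ) →
  ∑ (allVecs m (suc k)) F ≡ ∑[ x ∈ allFin m ] ∑[ g ∈ allVecs m k ] F (x ∷ᵥ g)
∑-allVecs-suc m k F = trans (∑-concatMap (allFin m) (λ x → map (x ∷ᵥ_) (allVecs m k)) F)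
  (∑-cong (allFin m) (λ x → ∑-map (allVecs m k) (x ∷ᵥ_) F))

length-allVecs : ∀ m k → length (allVecs m k) ≡ m ^ k
length-allVecs m zero    = refl
length-allVecs m (suc k) = begin
    length (allVecs m (suc k))                    ≡⟨ length≡∑1 (allVecs m (suc k)) ⟩
    ∑[ _ ∈ allVecs m (suc k) ] 1                  ≡⟨ ∑-allVecs-suc m k _ ⟩
    ∑[ _ ∈ allFin m ] ∑[ _ ∈ allVecs m k ] 1      ≡⟨ ∑-cong (allFin m) (λ _ → trans (sym (length≡∑1 (allVecs m k))) (length-allVecs m k)) ⟩
    ∑[ _ ∈ allFin m ] (m ^ k)                      ≡⟨ ∑-const (allFin m) (m ^ k) ⟩
    length (allFin m) * m ^ k                     ≡⟨ cong (_* m ^ k) (length-allFin m) ⟩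
    m * m ^ k ∎
  where
  open ≡-Reasoning
  length≡∑1 : ∀ {A : Set} (L : List A) → length L ≡ ∑[ _ ∈ L ] 1
  length≡∑1 L = sym (trans (∑-const L 1) (*-identityʳ (length L)))

∑-allVecs-lookup : ∀ m k (v : Fin k) (F : Fin m → ℕ) →
  ∑[ g ∈ allVecs m k ] F (lookup g v) ≡ m ^ (k ∸ 1) * ∑ (allFin m) F
∑-allVecs-lookup m (suc k) zero F = begin
    ∑[ g ∈ allVecs m (suc k) ] F (lookup g zero)      ≡⟨ ∑-allVecs-suc m k _ ⟩
    ∑[ x ∈ allFin m ] ∑[ _ ∈ allVecs m k ] F x        ≡⟨ ∑-cong (allFin m) (λ x → ∑-const (allVecs m k) (F x)) ⟩
    ∑[ x ∈ allFin m ] (length (allVecs m k) * F x)    ≡⟨ ∑-*ˡ (allFin m) (length (allVecs m k)) F ⟩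
    length (allVecs m k) * ∑ (allFin m) F             ≡⟨ cong (_* ∑ (allFin m) F) (length-allVecs m k) ⟩
    m ^ k * ∑ (allFin m) F ∎
  where open ≡-Reasoning
∑-allVecs-lookup m (suc (suc k)) (suc v) F = begin
    ∑[ g ∈ allVecs m (suc (suc k)) ] F (lookup g (suc v))             ≡⟨ ∑-allVecs-suc m (suc k) _ ⟩
    ∑[ _ ∈ allFin m ] ∑[ g ∈ allVecs m (suc k) ] F (lookup g v)       ≡⟨ ∑-cong (allFin m) (λ _ → ∑-allVecs-lookup m (suc k) v F) ⟩
    ∑[ _ ∈ allFin m ] (m ^ k * ∑ (allFin m) F)                        ≡⟨ ∑-const (allFin m) _ ⟩
    length (allFin m) * (m ^ k * ∑ (allFin m) F)                      ≡⟨ cong (_* (m ^ k * ∑ (allFin m) F)) (length-allFin m) ⟩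
    m * (m ^ k * ∑ (allFin m) F)                                      ≡⟨ sym (*-assoc m (m ^ k) _) ⟩
    m * m ^ k * ∑ (allFin m) F ∎
  where open ≡-Reasoning

∑-allVecs-δ : ∀ m k (f : Vec (Fin m) k) (Z : Vec (Fin m) k → ℕ) → ∑[ f′ ∈ allVecs m k ] (𝟙 ⌊ f ≟ᵛ f′ ⌋ * Z f′) ≡ Z f
∑-allVecs-δ m zero    []ᵥ      Z = trans (+-identityʳ _) (+-identityʳ _)
∑-allVecs-δ m (suc k) (a ∷ᵥ f) Z = begin
    ∑[ f′ ∈ allVecs m (suc k) ] (𝟙 ⌊ (a ∷ᵥ f) ≟ᵛ f′ ⌋ * Z f′)
      ≡⟨ ∑-allVecs-suc m k _ ⟩
    ∑[ x ∈ allFin m ] ∑[ f′ ∈ allVecs m k ] (𝟙 ⌊ (a ∷ᵥ f) ≟ᵛ (x ∷ᵥ f′) ⌋ * Z (x ∷ᵥ f′))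
      ≡⟨ ∑-cong (allFin m) (λ x → ∑-cong (allVecs m k) (λ f′ → split x f′)) ⟩
    ∑[ x ∈ allFin m ] ∑[ f′ ∈ allVecs m k ] (𝟙 ⌊ a ≟ᶠ x ⌋ * (𝟙 ⌊ f ≟ᵛ f′ ⌋ * Z (x ∷ᵥ f′)))
      ≡⟨ ∑-cong (allFin m) (λ x → trans (∑-*ˡ (allVecs m k) (𝟙 ⌊ a ≟ᶠ x ⌋) _)
                                        (cong (𝟙 ⌊ a ≟ᶠ x ⌋ *_) (∑-allVecs-δ m k f (λ f′ → Z (x ∷ᵥ f′))))) ⟩
    ∑[ x ∈ allFin m ] (𝟙 ⌊ a ≟ᶠ x ⌋ * Z (x ∷ᵥ f))
      ≡⟨ ∑-allFin-δ m a (λ x → Z (x ∷ᵥ f)) ⟩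
    Z (a ∷ᵥ f) ∎
  where
  open ≡-Reasoning
  split : ∀ x f′ → 𝟙 ⌊ (a ∷ᵥ f) ≟ᵛ (x ∷ᵥ f′) ⌋ * Z (x ∷ᵥ f′) ≡
                   𝟙 ⌊ a ≟ᶠ x ⌋ * (𝟙 ⌊ f ≟ᵛ f′ ⌋ * Z (x ∷ᵥ f′))
  split x f′ = trans (cong (λ b → 𝟙 b * Z (x ∷ᵥ f′)) (≟ᵛ-∷ a x f f′))
                     (trans (cong (_* Z (x ∷ᵥ f′)) (𝟙-∧ ⌊ a ≟ᶠ x ⌋ _)) (*-assoc (𝟙 ⌊ a ≟ᶠ x ⌋) _ _))

∑-allVecs-agreeExcept : ∀ m k (v : Fin k) (f : Vec (Fin m) k) (Z : Vec (Fin m) k → ℕ) →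
  ∑[ f′ ∈ allVecs m k ] (𝟙 (agreeExcept? v f f′) * Z f′) ≡ ∑[ h ∈ allFin m ] Z (f [ v ]≔ h)
∑-allVecs-agreeExcept m (suc k) zero (a ∷ᵥ f) Z =
  trans (∑-allVecs-suc m k _) (∑-cong (allFin m) (λ x → ∑-allVecs-δ m k f (λ f′ → Z (x ∷ᵥ f′))))
∑-allVecs-agreeExcept m (suc k) (suc v) (a ∷ᵥ f) Z = begin
    ∑[ f′ ∈ allVecs m (suc k) ] (𝟙 (agreeExcept? (suc v) (a ∷ᵥ f) f′) * Z f′)
      ≡⟨ ∑-allVecs-suc m k _ ⟩
    ∑[ x ∈ allFin m ] ∑[ f′ ∈ allVecs m k ] (𝟙 (⌊ a ≟ᶠ x ⌋ ∧ agreeExcept? v f f′) * Z (x ∷ᵥ f′))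
      ≡⟨ ∑-cong (allFin m) (λ x → ∑-cong (allVecs m k) (λ f′ →
           trans (cong (_* Z (x ∷ᵥ f′)) (𝟙-∧ ⌊ a ≟ᶠ x ⌋ _)) (*-assoc (𝟙 ⌊ a ≟ᶠ x ⌋) _ _))) ⟩
    ∑[ x ∈ allFin m ] ∑[ f′ ∈ allVecs m k ] (𝟙 ⌊ a ≟ᶠ x ⌋ * (𝟙 (agreeExcept? v f f′) * Z (x ∷ᵥ f′)))
      ≡⟨ ∑-cong (allFin m) (λ x → trans (∑-*ˡ (allVecs m k) (𝟙 ⌊ a ≟ᶠ x ⌋) _)
                                        (cong (𝟙 ⌊ a ≟ᶠ x ⌋ *_) (∑-allVecs-agreeExcept m k v f (λ f′ → Z (x ∷ᵥ f′))))) ⟩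
    ∑[ x ∈ allFin m ] (𝟙 ⌊ a ≟ᶠ x ⌋ * ∑[ h ∈ allFin m ] Z (x ∷ᵥ (f [ v ]≔ h)))
      ≡⟨ ∑-allFin-δ m a _ ⟩
    ∑[ h ∈ allFin m ] Z (a ∷ᵥ (f [ v ]≔ h)) ∎
  where open ≡-Reasoning

∑-allFin-≢ : ∀ m (y : Fin m) (F : Bool → ℕ) → ∑[ x ∈ allFin m ] F (not ⌊ x ≟ᶠ y ⌋) ≡ (m ∸ 1) * F true + F false
∑-allFin-≢ (suc m) zero F = begin
    ∑[ x ∈ allFin (suc m) ] F (not ⌊ x ≟ᶠ zero ⌋) ≡⟨ ∑-allFin-suc m (λ x → F (not ⌊ x ≟ᶠ zero ⌋)) ⟩
    F false + ∑[ _ ∈ allFin m ] F true            ≡⟨ cong (F false +_) (∑-const (allFin m) (F true)) ⟩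
    F false + length (allFin m) * F true          ≡⟨ +-comm (F false) _ ⟩
    length (allFin m) * F true + F false          ≡⟨ cong (λ l → l * F true + F false) (length-allFin m) ⟩
    m * F true + F false ∎
  where open ≡-Reasoning
∑-allFin-≢ (suc (suc m)) (suc y) F = begin
    ∑[ x ∈ allFin (suc (suc m)) ] F (not ⌊ x ≟ᶠ suc y ⌋)
      ≡⟨ ∑-allFin-suc (suc m) (λ x → F (not ⌊ x ≟ᶠ suc y ⌋)) ⟩
    F true + ∑[ x ∈ allFin (suc m) ] F (not ⌊ suc x ≟ᶠ suc y ⌋)
      ≡⟨ cong (F true +_) (∑-cong (allFin (suc m)) (λ x → cong (F ∘ not) (≟-suc x y))) ⟩
    F true + ∑[ x ∈ allFin (suc m) ] F (not ⌊ x ≟ᶠ y ⌋)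
      ≡⟨ cong (F true +_) (∑-allFin-≢ (suc m) y F) ⟩
    F true + (m * F true + F false)
      ≡⟨ sym (+-assoc (F true) (m * F true) (F false)) ⟩
    suc m * F true + F false ∎
  where open ≡-Reasoning

∑-allSubsets-suc : ∀ k (F : Subset (suc k) → ℕ) →
  ∑ (allSubsets (suc k)) F ≡ ∑[ A ∈ allSubsets k ] F (true ∷ᵥ A) + ∑[ A ∈ allSubsets k ] F (false ∷ᵥ A)
∑-allSubsets-suc k F = begin
    ∑ (allSubsets (suc k)) F
      ≡⟨ ∑-concatMap (true ∷ false ∷ []) (λ b → map (b ∷ᵥ_) (allSubsets k)) F ⟩
    ∑ (map (true ∷ᵥ_) (allSubsets k)) F + (∑ (map (false ∷ᵥ_) (allSubsets k)) F + 0)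
      ≡⟨ cong₂ _+_ (∑-map (allSubsets k) (true ∷ᵥ_) F) (trans (+-identityʳ _) (∑-map (allSubsets k) (false ∷ᵥ_) F)) ⟩
    ∑[ A ∈ allSubsets k ] F (true ∷ᵥ A) + ∑[ A ∈ allSubsets k ] F (false ∷ᵥ A) ∎
  where open ≡-Reasoning

-- For each A there are exactly (m ∸ 1)^|A| maps g that differ from f precisely on A.
∑-allVecs-differ : ∀ {m k} (f : Vec (Fin m) k) (F : Subset k → ℕ) →
  ∑[ g ∈ allVecs m k ] F (differ g f) ≡ ∑[ A ∈ allSubsets k ] ((m ∸ 1) ^ ∣ A ∣ * F A)
∑-allVecs-differ         []ᵥ      F = cong (_+ 0) (sym (*-identityˡ (F []ᵥ)))
∑-allVecs-differ {m} {suc k} (y ∷ᵥ f) F = begin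
    ∑[ g ∈ allVecs m (suc k) ] F (differ g (y ∷ᵥ f))
      ≡⟨ ∑-allVecs-suc m k _ ⟩
    ∑[ x ∈ allFin m ] ∑[ g ∈ allVecs m k ] F (not ⌊ x ≟ᶠ y ⌋ ∷ᵥ differ g f)
      ≡⟨ ∑-cong (allFin m) (λ x → ∑-allVecs-differ f (λ A → F (not ⌊ x ≟ᶠ y ⌋ ∷ᵥ A))) ⟩
    ∑[ x ∈ allFin m ] ∑[ A ∈ allSubsets k ] (w A * F (not ⌊ x ≟ᶠ y ⌋ ∷ᵥ A))
      ≡⟨ ∑-comm (allFin m) (allSubsets k) _ ⟩
    ∑[ A ∈ allSubsets k ] ∑[ x ∈ allFin m ] (w A * F (not ⌊ x ≟ᶠ y ⌋ ∷ᵥ A))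
      ≡⟨ ∑-cong (allSubsets k) (λ A → trans (∑-*ˡ (allFin m) (w A) _) (cong (w A *_) (∑-allFin-≢ m y (λ b → F (b ∷ᵥ A))))) ⟩
    ∑[ A ∈ allSubsets k ] (w A * ((m ∸ 1) * F (true ∷ᵥ A) + F (false ∷ᵥ A)))
      ≡⟨ ∑-cong (allSubsets k) (λ A → distrib (w A) (m ∸ 1) _ _) ⟩
    ∑[ A ∈ allSubsets k ] ((m ∸ 1) * w A * F (true ∷ᵥ A) + w A * F (false ∷ᵥ A))
      ≡⟨ ∑-+ (allSubsets k) _ _ ⟩
    ∑[ A ∈ allSubsets k ] ((m ∸ 1) * w A * F (true ∷ᵥ A)) + ∑[ A ∈ allSubsets k ] (w A * F (false ∷ᵥ A))
      ≡⟨ sym (∑-allSubsets-suc k _) ⟩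
    ∑[ A ∈ allSubsets (suc k) ] (w A * F A) ∎
  where
  open ≡-Reasoning
  w : ∀ {j} → Subset j → ℕ
  w A = (m ∸ 1) ^ ∣ A ∣
  distrib : ∀ a c x y → a * (c * x + y) ≡ c * a * x + a * y
  distrib = solve-∀

allVecs-complete : ∀ m k (f : Vec (Fin m) k) → f ∈ allVecs m k
allVecs-complete m zero    []ᵥ      = here refl
allVecs-complete m (suc k) (x ∷ᵥ f) =
  ∈-concatMap⁺ (λ y → map (y ∷ᵥ_) (allVecs m k)) (lose (∈-allFin x) (∈-map⁺ (x ∷ᵥ_) (allVecs-complete m k f)))

module Wreath {n m : ℕ} (G : Graph n) (H : Graph m) (connectedG : Connected G) (connectedH : Connected H) where
  open CoveringWalks G
  module WH = Walks (toFinGraph H)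
  module WW = Walks (wreath G H)

  wadj : Vec (Fin m) n × Fin n → Vec (Fin m) n × Fin n → Bool
  wadj = FinGraph.adj (wreath G H)

  wreath-complete : ∀ p → p ∈ FinGraph.verts (wreath G H)
  wreath-complete (f , v) =
    ∈-concatMap⁺ (λ g → map (g ,_) (allFin n)) (lose (allVecs-complete m n f) (∈-map⁺ (f ,_) (∈-allFin v)))

  distH : Fin m → Fin m → ℕ
  distH = dist (toFinGraph H)

  walk-distH : ∀ a b → WH.LWalk a b (distH a b)
  walk-distH a b = WH.walk-dist ∈-allFin (proj₂ (Walk⇒LWalk H (connectedH a b)))

  distH-refl : ∀ a → distH a a ≡ 0
  distH-refl a = n≤0⇒n≡0 (WH.dist-≤ ∈-allFin WH.nil)

  distH-step : ∀ {a b} c → Graph.adj H a b ≡ true → distH a c ≤ suc (distH b c)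
  distH-step c e = WH.dist-≤ ∈-allFin (WH.cons e (walk-distH _ c))

  lampDist : ∀ {k} → Vec (Fin m) k → Vec (Fin m) k → ℕ
  lampDist []ᵥ       []ᵥ       = 0
  lampDist (a ∷ᵥ g) (b ∷ᵥ f) = distH a b + lampDist g f

  lampDistExcept : ∀ {k} → Fin k → Vec (Fin m) k → Vec (Fin m) k → ℕ
  lampDistExcept zero    (a ∷ᵥ g) (b ∷ᵥ f) = lampDist g f
  lampDistExcept (suc i) (a ∷ᵥ g) (b ∷ᵥ f) = distH a b + lampDistExcept i g f

  lampDist-split : ∀ {k} i (g f : Vec (Fin m) k) → lampDist g f ≡ lampDistExcept i g f + distH (lookup g i) (lookup f i)
  lampDist-split zero    (a ∷ᵥ g) (b ∷ᵥ f) = +-comm (distH a b) (lampDist g f)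
  lampDist-split (suc i) (a ∷ᵥ g) (b ∷ᵥ f) = trans (cong (distH a b +_) (lampDist-split i g f)) (sym (+-assoc (distH a b) _ _))

  lampDistExcept-cong : ∀ {k} i (g g′ f f′ : Vec (Fin m) k) → AgreeExcept i g g′ → AgreeExcept i f f′ →
                        lampDistExcept i g f ≡ lampDistExcept i g′ f′
  lampDistExcept-cong zero (_ ∷ᵥ g) (_ ∷ᵥ g′) (_ ∷ᵥ f) (_ ∷ᵥ f′) g≈g′ f≈f′ =
    cong₂ lampDist (lookup-ext g g′ (λ w → g≈g′ (suc w) (λ ()))) (lookup-ext f f′ (λ w → f≈f′ (suc w) (λ ())))
  lampDistExcept-cong (suc i) (_ ∷ᵥ g) (_ ∷ᵥ g′) (_ ∷ᵥ f) (_ ∷ᵥ f′) g≈g′ f≈f′ =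
    cong₂ _+_ (cong₂ distH (g≈g′ zero (λ ())) (f≈f′ zero (λ ())))
      (lampDistExcept-cong i g g′ f f′ (λ w w≢i → g≈g′ (suc w) (w≢i ∘ FinP.suc-injective))
                             (λ w w≢i → f≈f′ (suc w) (w≢i ∘ FinP.suc-injective)))

  distH-≤-lampDist : ∀ {k} i (g f : Vec (Fin m) k) → distH (lookup g i) (lookup f i) ≤ lampDist g f
  distH-≤-lampDist i g f = ≤-trans (m≤n+m _ (lampDistExcept i g f)) (≤-reflexive (sym (lampDist-split i g f)))

  lampDist-self : ∀ {k} (f : Vec (Fin m) k) → lampDist f f ≡ 0
  lampDist-self []ᵥ      = refl
  lampDist-self (a ∷ᵥ f) rewrite distH-refl a = lampDist-self f

  agreeExcept-all : Fin n → Vec (Fin m) n → Vec (Fin m) n → Bool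
  agreeExcept-all v f f′ = all (λ w → ⌊ w ≟ᶠ v ⌋ ∨ ⌊ lookup f w ≟ᶠ lookup f′ w ⌋) (allFin n)

  agreeExcept-all-true⁺ : ∀ v f f′ → AgreeExcept v f f′ → agreeExcept-all v f f′ ≡ true
  agreeExcept-all-true⁺ v f f′ f≈f′ = all-true⁺ _ (allFin n) holds
    where
    holds : ∀ {w} → w ∈ allFin n → (⌊ w ≟ᶠ v ⌋ ∨ ⌊ lookup f w ≟ᶠ lookup f′ w ⌋) ≡ true
    holds {w} _ with w ≟ᶠ v
    ... | yes _   = refl
    ... | no  w≢v = ⌊⌋-true⁺ (lookup f w ≟ᶠ lookup f′ w) (f≈f′ w w≢v)

  agreeExcept-all-true⁻ : ∀ v f f′ → agreeExcept-all v f f′ ≡ true → AgreeExcept v f f′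
  agreeExcept-all-true⁻ v f f′ e w w≢v with ∨-true⁻ ⌊ w ≟ᶠ v ⌋ (all-true⁻ _ (allFin n) e (∈-allFin w))
  ... | inj₁ w≡v    = ⊥-elim (w≢v (⌊⌋-true⁻ (w ≟ᶠ v) w≡v))
  ... | inj₂ fw≡f′w = ⌊⌋-true⁻ (lookup f w ≟ᶠ lookup f′ w) fw≡f′w

  wadj-lamp : ∀ (g : Vec (Fin m) n) y c → Graph.adj H (lookup g y) c ≡ true → wadj (g , y) (g [ y ]≔ c , y) ≡ true
  wadj-lamp g y c e rewrite ⌊⌋-true⁺ (y ≟ᶠ y) refl
                          | agreeExcept-all-true⁺ y g (g [ y ]≔ c) (AgreeExcept-update g y c)
                          | VecP.lookup∘update y g c | e = refl

  wadj-base : ∀ (g : Vec (Fin m) n) y z → Graph.adj G y z ≡ true → wadj (g , y) (g , z) ≡ true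
  wadj-base g y z e rewrite ⌊⌋-true⁺ (g ≟ᵛ g) refl | e = ∨-zeroʳ _

  wadj-true⁻ : ∀ g g′ y y′ → wadj (g , y) (g′ , y′) ≡ true →
    (y ≡ y′ × AgreeExcept y g g′ × Graph.adj H (lookup g y) (lookup g′ y) ≡ true) ⊎ (g ≡ g′ × Graph.adj G y y′ ≡ true)
  wadj-true⁻ g g′ y y′ e with ∨-true⁻ _ e
  ... | inj₂ base = inj₂ (⌊⌋-true⁻ (g ≟ᵛ g′) (∧-conicalˡ _ _ base) , ∧-conicalʳ _ _ base)
  ... | inj₁ lamp with ⌊⌋-true⁻ (y ≟ᶠ y′) (∧-conicalˡ _ _ lamp)
  ... | refl = inj₁ (refl , agreeExcept-all-true⁻ y g g′ (∧-conicalˡ _ _ rest) , ∧-conicalʳ (agreeExcept-all y g g′) _ rest)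
    where
    rest : agreeExcept-all y g g′ ∧ Graph.adj H (lookup g y) (lookup g′ y) ≡ true
    rest = ∧-conicalʳ ⌊ y ≟ᶠ y ⌋ _ lamp

  liftWalk : ∀ {a b k} → WH.LWalk a b k → ∀ (g : Vec (Fin m) n) y → lookup g y ≡ a → WW.LWalk (g , y) (g [ y ]≔ b , y) k
  liftWalk WH.nil g y refl = subst (λ h → WW.LWalk (g , y) (h , y) 0) (sym (VecP.[]≔-lookup g y)) WW.nil
  liftWalk {b = b} (WH.cons {x = x} e W) g y refl =
    WW.cons (wadj-lamp g y x e)
      (subst (λ h → WW.LWalk (g [ y ]≔ x , y) (h , y) _) (VecP.[]≔-idempotent g y)
             (liftWalk W (g [ y ]≔ x) y (VecP.lookup∘update y g x)))

  wreathDist : Vec (Fin m) n → Fin n → Vec (Fin m) n → Fin n → ℕ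
  wreathDist g x f v = ρ G (differ g f) x v + lampDist g f

  ρ-lampStep : ∀ (g g′ f : Vec (Fin m) n) {y v} → AgreeExcept y g g′ → ρ G (differ g f) y v ≤ ρ G (differ g′ f) y v
  ρ-lampStep g g′ f {y} {v} g≈g′ = ρ-≤ (Covering-⊆ (ρ-covering connectedG (differ g′ f) y v) D⊆D′)
    where
    D⊆D′ : differ g f ⊆ differ g′ f ∪⟨ y , v ⟩
    D⊆D′ i e with i ≟ᶠ y
    ... | yes i≡y = inj₂ (inj₁ i≡y)
    ... | no  i≢y = inj₁ (differ-true⁺ g′ f i (λ g′ᵢ≡fᵢ → differ-true⁻ g f i e (trans (g≈g′ i i≢y) g′ᵢ≡fᵢ)))

  lampDist-lampStep : ∀ (g g′ f : Vec (Fin m) n) {y} → AgreeExcept y g g′ → Graph.adj H (lookup g y) (lookup g′ y) ≡ true →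
                      lampDist g f ≤ suc (lampDist g′ f)
  lampDist-lampStep g g′ f {y} g≈g′ e = begin
      lampDist g f                                               ≡⟨ lampDist-split y g f ⟩
      lampDistExcept y g f + distH (lookup g y) (lookup f y)     ≡⟨ cong (_+ _) (lampDistExcept-cong y g g′ f f g≈g′ (λ _ _ → refl)) ⟩
      lampDistExcept y g′ f + distH (lookup g y) (lookup f y)    ≤⟨ +-monoʳ-≤ _ (distH-step (lookup f y) e) ⟩
      lampDistExcept y g′ f + suc (distH (lookup g′ y) (lookup f y)) ≡⟨ +-suc _ _ ⟩
      suc (lampDistExcept y g′ f + distH (lookup g′ y) (lookup f y)) ≡⟨ cong suc (sym (lampDist-split y g′ f)) ⟩
      suc (lampDist g′ f) ∎
    where open ≤-Reasoning

  ρ-baseStep : ∀ {S y y′ v} → Graph.adj G y y′ ≡ true → ρ G S y v ≤ suc (ρ G S y′ v)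
  ρ-baseStep {S} {y} {y′} {v} e =
    ρ-≤ (go e (Covering-⊆ (ρ-covering connectedG S y′ v) (λ i e′ → inj₁ (proj₁ (∖-true⁻ S y i e′)))))

  wreathDist-≤ : ∀ {g y f v k} → WW.LWalk (g , y) (f , v) k → wreathDist g y f v ≤ k
  wreathDist-≤ {f = f} {v = v} WW.nil =
    ≤-reflexive (cong₂ _+_ (n≤0⇒n≡0 (ρ-≤ (stop (isEmpty-true⁺ (differ f f ∖ v) nothingLeft)))) (lampDist-self f))
    where
    nothingLeft : ∀ i → lookup (differ f f ∖ v) i ≡ false
    nothingLeft i with i ≟ᶠ v
    ... | yes refl = lookup-∖-self (differ f f) i
    ... | no  i≢v  = trans (lookup-∖-other (differ f f) i≢v) (differ-false⁺ f f i refl)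
  wreathDist-≤ {g} {y} {f} (WW.cons {x = g′ , y′} e W) with wadj-true⁻ g g′ y y′ e
  ... | inj₁ (refl , g≈g′ , lampEdge) =
    ≤-trans (+-mono-≤ (ρ-lampStep g g′ f g≈g′) (lampDist-lampStep g g′ f g≈g′ lampEdge))
            (≤-trans (≤-reflexive (+-suc _ _)) (s≤s (wreathDist-≤ W)))
  ... | inj₂ (refl , baseEdge) = ≤-trans (+-monoˡ-≤ _ (ρ-baseStep baseEdge)) (s≤s (wreathDist-≤ W))

  lampDist-fixLamp : ∀ (g f : Vec (Fin m) n) y → lampDist (g [ y ]≔ lookup f y) f ≡ lampDistExcept y g f
  lampDist-fixLamp g f y = begin
      lampDist g₁ f                                             ≡⟨ lampDist-split y g₁ f ⟩
      lampDistExcept y g₁ f + distH (lookup g₁ y) (lookup f y)  ≡⟨ cong₂ _+_ (lampDistExcept-cong y g₁ g f f g₁≈g (λ _ _ → refl))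
                                                                            (cong (λ c → distH c (lookup f y)) (VecP.lookup∘update y g _)) ⟩
      lampDistExcept y g f + distH (lookup f y) (lookup f y)    ≡⟨ cong (lampDistExcept y g f +_) (distH-refl (lookup f y)) ⟩
      lampDistExcept y g f + 0                                  ≡⟨ +-identityʳ _ ⟩
      lampDistExcept y g f ∎
    where
    open ≡-Reasoning
    g₁ : Vec (Fin m) n
    g₁ = g [ y ]≔ lookup f y
    g₁≈g : AgreeExcept y g₁ g
    g₁≈g w w≢y = sym (AgreeExcept-update g y _ w w≢y)

  -- Follow the covering walk in G, switching each lamp to its target value when first visited.
  walk-wreathDist : ∀ {k y v S} (g f : Vec (Fin m) n) → Covering k y v S →
    (∀ i → lookup (differ g f) i ≡ true → lookup S i ≡ true) → ∃ λ j → j ≤ k + lampDist g f × WW.LWalk (g , y) (f , v) j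
  walk-wreathDist {k} {y} {S = S} g f (stop e) D⊆S =
    d , ≤-trans (distH-≤-lampDist y g f) (m≤n+m (lampDist g f) k) ,
    subst (λ h → WW.LWalk (g , y) (h , y) d) (update-AgreeExcept g f y g≈f) (liftWalk (walk-distH _ _) g y refl)
    where
    d : ℕ
    d = distH (lookup g y) (lookup f y)
    g≈f : AgreeExcept y g f
    g≈f i i≢y = differ-false⁻ g f i λ Dᵢ →
      false≢true (trans (sym (isEmpty-true⁻ (S ∖ y) e i)) (trans (lookup-∖-other S i≢y) (D⊆S i Dᵢ)))
  walk-wreathDist {suc k} {y} {v} {S} g f (go {y = z} e C) D⊆S
    with walk-wreathDist (g [ y ]≔ lookup f y) f C D₁⊆S∖y
    where
    D₁⊆S∖y : ∀ i → lookup (differ (g [ y ]≔ lookup f y) f) i ≡ true → lookup (S ∖ y) i ≡ true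
    D₁⊆S∖y i Dᵢ with i ≟ᶠ y
    ... | yes refl = ⊥-elim (differ-true⁻ (g [ i ]≔ lookup f i) f i Dᵢ (VecP.lookup∘update i g (lookup f i)))
    ... | no  i≢y  = trans (lookup-∖-other S i≢y) (D⊆S i (differ-true⁺ g f i λ gᵢ≡fᵢ →
                       differ-true⁻ (g [ y ]≔ lookup f y) f i Dᵢ (trans (VecP.lookup∘update′ i≢y g (lookup f y)) gᵢ≡fᵢ)))
  ... | j , j≤ , W = d + suc j , length-≤ ,
                     liftWalk (walk-distH (lookup g y) (lookup f y)) g y refl WW.++ʷ WW.cons (wadj-base _ y z e) W
    where
    d : ℕ
    d = distH (lookup g y) (lookup f y)
    reassoc : ∀ d k s → d + suc (k + s) ≡ suc k + (s + d)
    reassoc = solve-∀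
    length-≤ : d + suc j ≤ suc k + lampDist g f
    length-≤ = ≤-trans (+-monoʳ-≤ d (s≤s (≤-trans j≤ (≤-reflexive (cong (k +_) (lampDist-fixLamp g f y))))))
                       (≤-reflexive (trans (reassoc d k _) (cong (suc k +_) (sym (lampDist-split y g f)))))

  dist-wreath : ∀ g x f v → dist (wreath G H) (g , x) (f , v) ≡ wreathDist g x f v
  dist-wreath g x f v with walk-wreathDist g f (ρ-covering connectedG (differ g f) x v) (λ _ Dᵢ → Dᵢ)
  ... | j , j≤ , W = ≤-antisym (≤-trans (WW.dist-≤ wreath-complete W) j≤) (wreathDist-≤ (WW.walk-dist wreath-complete W))

  wadj-sym : ∀ a b → wadj a b ≡ wadj b a
  wadj-sym a b = Bool-⇔ (flipEdge a b) (flipEdge b a)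
    where
    flipEdge : ∀ a b → wadj a b ≡ true → wadj b a ≡ true
    flipEdge (g , y) (g′ , y′) e with wadj-true⁻ g g′ y y′ e
    ... | inj₂ (refl , baseEdge) = wadj-base g y′ y (trans (Graph.sym G y′ y) baseEdge)
    ... | inj₁ (refl , g≈g′ , lampEdge) =
      subst (λ h → wadj (g′ , y) (h , y) ≡ true) (update-AgreeExcept g′ g y (λ i i≢y → sym (g≈g′ i i≢y)))
        (wadj-lamp g′ y (lookup g y) (trans (Graph.sym H _ _) lampEdge))

  wadj-irrefl : ∀ a → wadj a a ≡ false
  wadj-irrefl (g , y) = ≢true⇒≡false λ e → loopless (wadj-true⁻ g g y y e)
    where
    loopless : (y ≡ y × AgreeExcept y g g × Graph.adj H (lookup g y) (lookup g y) ≡ true) ⊎ (g ≡ g × Graph.adj G y y ≡ true) → ⊥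
    loopless (inj₁ (_ , _ , lampEdge)) = false≢true (trans (sym (Graph.irrefl H (lookup g y))) lampEdge)
    loopless (inj₂ (_ , baseEdge))     = false≢true (trans (sym (Graph.irrefl G y)) baseEdge)

  agreeExcept-all≡agreeExcept? : ∀ v f f′ → agreeExcept-all v f f′ ≡ agreeExcept? v f f′
  agreeExcept-all≡agreeExcept? v f f′ = Bool-⇔
    (λ e → agreeExcept?-true⁺ v f f′ (agreeExcept-all-true⁻ v f f′ e))
    (λ e → agreeExcept-all-true⁺ v f f′ (agreeExcept?-true⁻ v f f′ e))

  𝟙-wadj : ∀ f v f′ v′ → 𝟙 (wadj (f , v) (f′ , v′)) ≡
      𝟙 ⌊ v ≟ᶠ v′ ⌋ * (𝟙 (agreeExcept? v f f′) * 𝟙 (Graph.adj H (lookup f v) (lookup f′ v)))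
    + 𝟙 ⌊ f ≟ᵛ f′ ⌋ * 𝟙 (Graph.adj G v v′)
  𝟙-wadj f v f′ v′ = trans (𝟙-∨ lamp base exclusive) (cong₂ _+_
    (trans (𝟙-∧ ⌊ v ≟ᶠ v′ ⌋ _) (cong (𝟙 ⌊ v ≟ᶠ v′ ⌋ *_)
      (trans (𝟙-∧ (agreeExcept-all v f f′) _)
             (cong (λ b → 𝟙 b * 𝟙 (Graph.adj H (lookup f v) (lookup f′ v))) (agreeExcept-all≡agreeExcept? v f f′)))))
    (𝟙-∧ ⌊ f ≟ᵛ f′ ⌋ _))
    where
    lamp base : Bool
    lamp = ⌊ v ≟ᶠ v′ ⌋ ∧ agreeExcept-all v f f′ ∧ Graph.adj H (lookup f v) (lookup f′ v)
    base = ⌊ f ≟ᵛ f′ ⌋ ∧ Graph.adj G v v′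
    exclusive : lamp ≡ true → base ≡ true → ⊥
    exclusive e₁ e₂ with ⌊⌋-true⁻ (f ≟ᵛ f′) (∧-conicalˡ _ _ e₂)
    ... | refl = false≢true (trans (sym (Graph.irrefl H (lookup f v)))
                   (∧-conicalʳ (agreeExcept-all v f f) _ (∧-conicalʳ ⌊ v ≟ᶠ v′ ⌋ _ e₁)))

  wreathVerts : List (Vec (Fin m) n × Fin n)
  wreathVerts = FinGraph.verts (wreath G H)

  ∑-wreathVerts : ∀ (F : Vec (Fin m) n × Fin n → ℕ) → ∑ wreathVerts F ≡ ∑[ g ∈ allVecs m n ] ∑[ x ∈ allFin n ] F (g , x)
  ∑-wreathVerts F = trans (∑-concatMap (allVecs m n) (λ f → map (f ,_) (allFin n)) F)
                          (∑-cong (allVecs m n) (λ g → ∑-map (allFin n) (g ,_) F))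

  ∑-neighbours : ∀ f v (X : Vec (Fin m) n × Fin n → ℕ) →
    ∑[ b ∈ wreathVerts ] (𝟙 (wadj (f , v) b) * X b) ≡
      ∑[ h ∈ allFin m ] (𝟙 (Graph.adj H (lookup f v) h) * X (f [ v ]≔ h , v))
        + ∑[ v′ ∈ allFin n ] (𝟙 (Graph.adj G v v′) * X (f , v′))
  ∑-neighbours f v X = begin
      ∑[ b ∈ wreathVerts ] (𝟙 (wadj (f , v) b) * X b)
        ≡⟨ ∑-wreathVerts _ ⟩
      ∑[ f′ ∈ allVecs m n ] ∑[ v′ ∈ allFin n ] (𝟙 (wadj (f , v) (f′ , v′)) * X (f′ , v′))
        ≡⟨ ∑-cong (allVecs m n) (λ f′ → trans (∑-cong (allFin n) (split f′)) (∑-+ (allFin n) (Lamp f′) (Base f′))) ⟩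
      ∑[ f′ ∈ allVecs m n ] (∑[ v′ ∈ allFin n ] Lamp f′ v′ + ∑[ v′ ∈ allFin n ] Base f′ v′)
        ≡⟨ ∑-+ (allVecs m n) _ _ ⟩
      ∑[ f′ ∈ allVecs m n ] ∑[ v′ ∈ allFin n ] Lamp f′ v′ + ∑[ f′ ∈ allVecs m n ] ∑[ v′ ∈ allFin n ] Base f′ v′
        ≡⟨ cong₂ _+_ lampMoves baseMoves ⟩
      ∑[ h ∈ allFin m ] (𝟙 (Graph.adj H (lookup f v) h) * X (f [ v ]≔ h , v))
        + ∑[ v′ ∈ allFin n ] (𝟙 (Graph.adj G v v′) * X (f , v′)) ∎
    where
    open ≡-Reasoning
    distrib : ∀ a b c d e x → (a * (b * c) + d * e) * x ≡ a * (b * (c * x)) + d * (e * x)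
    distrib = solve-∀
    Lamp Base : Vec (Fin m) n → Fin n → ℕ
    Lamp f′ v′ = 𝟙 ⌊ v ≟ᶠ v′ ⌋ * (𝟙 (agreeExcept? v f f′) * (𝟙 (Graph.adj H (lookup f v) (lookup f′ v)) * X (f′ , v′)))
    Base f′ v′ = 𝟙 ⌊ f ≟ᵛ f′ ⌋ * (𝟙 (Graph.adj G v v′) * X (f′ , v′))
    split : ∀ f′ v′ → 𝟙 (wadj (f , v) (f′ , v′)) * X (f′ , v′) ≡ Lamp f′ v′ + Base f′ v′
    split f′ v′ = trans (cong (_* X (f′ , v′)) (𝟙-wadj f v f′ v′))
      (distrib (𝟙 ⌊ v ≟ᶠ v′ ⌋) (𝟙 (agreeExcept? v f f′)) (𝟙 (Graph.adj H (lookup f v) (lookup f′ v))) (𝟙 ⌊ f ≟ᵛ f′ ⌋)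
               (𝟙 (Graph.adj G v v′)) (X (f′ , v′)))
    lampMoves : ∑[ f′ ∈ allVecs m n ] ∑[ v′ ∈ allFin n ] Lamp f′ v′ ≡
                ∑[ h ∈ allFin m ] (𝟙 (Graph.adj H (lookup f v) h) * X (f [ v ]≔ h , v))
    lampMoves = begin
        ∑[ f′ ∈ allVecs m n ] ∑[ v′ ∈ allFin n ] Lamp f′ v′
          ≡⟨ ∑-cong (allVecs m n) (λ f′ → ∑-allFin-δ n v _) ⟩
        ∑[ f′ ∈ allVecs m n ] (𝟙 (agreeExcept? v f f′) * (𝟙 (Graph.adj H (lookup f v) (lookup f′ v)) * X (f′ , v)))
          ≡⟨ ∑-allVecs-agreeExcept m n v f (λ f′ → 𝟙 (Graph.adj H (lookup f v) (lookup f′ v)) * X (f′ , v)) ⟩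
        ∑[ h ∈ allFin m ] (𝟙 (Graph.adj H (lookup f v) (lookup (f [ v ]≔ h) v)) * X (f [ v ]≔ h , v))
          ≡⟨ ∑-cong (allFin m) (λ h → cong (λ c → 𝟙 (Graph.adj H (lookup f v) c) * X (f [ v ]≔ h , v)) (VecP.lookup∘update v f h)) ⟩
        ∑[ h ∈ allFin m ] (𝟙 (Graph.adj H (lookup f v) h) * X (f [ v ]≔ h , v)) ∎
    baseMoves : ∑[ f′ ∈ allVecs m n ] ∑[ v′ ∈ allFin n ] Base f′ v′ ≡ ∑[ v′ ∈ allFin n ] (𝟙 (Graph.adj G v v′) * X (f , v′))
    baseMoves = trans (∑-comm (allVecs m n) (allFin n) _)
                      (∑-cong (allFin n) (λ v′ → ∑-allVecs-δ m n f (λ f′ → 𝟙 (Graph.adj G v v′) * X (f′ , v′))))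

  𝟙< : ℕ → ℕ → ℕ
  𝟙< p q = 𝟙 (does (p <? q))

  𝟙<-+ˡ : ∀ c a b → 𝟙< (c + a) (c + b) ≡ 𝟙< a b
  𝟙<-+ˡ c a b = cong 𝟙 (does-⇔ (mk⇔ (+-cancelˡ-< c a b) (+-monoʳ-< c)) (c + a <? c + b) (a <? b))

  nVert-wreath : ∀ f v f′ v′ → nVert (wreath G H) (f , v) (f′ , v′) ≡
    ∑[ g ∈ allVecs m n ] ∑[ x ∈ allFin n ] 𝟙< (wreathDist g x f v) (wreathDist g x f′ v′)
  nVert-wreath f v f′ v′ =
    trans (length-filter≡∑𝟙 (λ p → dist (wreath G H) p (f , v) <? dist (wreath G H) p (f′ , v′)) wreathVerts)
      (trans (∑-wreathVerts _) (∑-cong (allVecs m n) (λ g → ∑-cong (allFin n) (λ x →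
         cong₂ 𝟙< (dist-wreath g x f v) (dist-wreath g x f′ v′)))))

  nVert-H : ∀ a b → nVert (toFinGraph H) a b ≡ ∑[ y ∈ allFin m ] 𝟙< (distH y a) (distH y b)
  nVert-H a b = length-filter≡∑𝟙 (λ y → distH y a <? distH y b) (allFin m)

  nρ≡∑ : ∀ A xj xk → nρ G A xj xk ≡ ∑[ x ∈ allFin n ] 𝟙< (ρ G A x xj) (ρ G A x xk)
  nρ≡∑ A xj xk = length-filter≡∑𝟙 (λ x → ρ G A x xj <? ρ G A x xk) (allFin n)

  -- The lamp at the target base vertex v is always visited, so it does not affect ρ.
  ρ-differ-AgreeExcept : ∀ (g f f′ : Vec (Fin m) n) x v → AgreeExcept v f f′ → ρ G (differ g f) x v ≡ ρ G (differ g f′) x v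
  ρ-differ-AgreeExcept g f f′ x v f≈f′ = ρ-cong connectedG (⊆-differ f f′ f≈f′) (⊆-differ f′ f (λ w w≢v → sym (f≈f′ w w≢v)))
    where
    ⊆-differ : ∀ f f′ → AgreeExcept v f f′ → differ g f ⊆ differ g f′ ∪⟨ x , v ⟩
    ⊆-differ f f′ f≈f′ i Dᵢ with i ≟ᶠ v
    ... | yes i≡v = inj₂ (inj₂ i≡v)
    ... | no  i≢v = inj₁ (differ-true⁺ g f′ i λ gᵢ≡f′ᵢ → differ-true⁻ g f i Dᵢ (trans gᵢ≡f′ᵢ (sym (f≈f′ i i≢v))))

  wreathDist-lampEdge : ∀ g x f v h → 𝟙< (wreathDist g x f v) (wreathDist g x (f [ v ]≔ h) v) ≡
                                      𝟙< (distH (lookup g v) (lookup f v)) (distH (lookup g v) h)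
  wreathDist-lampEdge g x f v h = begin
      𝟙< (ρ G (differ g f) x v + lampDist g f) (ρ G (differ g f′) x v + lampDist g f′)
        ≡⟨ cong₂ 𝟙< (cong (r +_) (lampDist-split v g f))
                    (cong₂ _+_ (sym (ρ-differ-AgreeExcept g f f′ x v f≈f′)) (lampDist-split v g f′)) ⟩
      𝟙< (r + (lampDistExcept v g f + distH (lookup g v) (lookup f v))) (r + (lampDistExcept v g f′ + distH (lookup g v) (lookup f′ v)))
        ≡⟨ cong₂ (λ e c → 𝟙< (r + (lampDistExcept v g f + distH (lookup g v) (lookup f v))) (r + (e + distH (lookup g v) c)))
                 (lampDistExcept-cong v g g f′ f (λ _ _ → refl) (λ w w≢v → sym (f≈f′ w w≢v))) (VecP.lookup∘update v f h) ⟩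
      𝟙< (r + (lampDistExcept v g f + distH (lookup g v) (lookup f v))) (r + (lampDistExcept v g f + distH (lookup g v) h))
        ≡⟨ cong₂ 𝟙< (sym (+-assoc r _ _)) (sym (+-assoc r _ _)) ⟩
      𝟙< (r + lampDistExcept v g f + distH (lookup g v) (lookup f v)) (r + lampDistExcept v g f + distH (lookup g v) h)
        ≡⟨ 𝟙<-+ˡ (r + lampDistExcept v g f) _ _ ⟩
      𝟙< (distH (lookup g v) (lookup f v)) (distH (lookup g v) h) ∎
    where
    open ≡-Reasoning
    f′ : Vec (Fin m) n
    f′ = f [ v ]≔ h
    r : ℕ
    r = ρ G (differ g f) x v
    f≈f′ : AgreeExcept v f f′
    f≈f′ = AgreeExcept-update f v h

  nVert-lampEdge : ∀ f v h → nVert (wreath G H) (f , v) (f [ v ]≔ h , v) ≡ n * m ^ (n ∸ 1) * nVert (toFinGraph H) (lookup f v) h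
  nVert-lampEdge f v h = begin
      nVert (wreath G H) (f , v) (f [ v ]≔ h , v)
        ≡⟨ nVert-wreath f v (f [ v ]≔ h) v ⟩
      ∑[ g ∈ allVecs m n ] ∑[ x ∈ allFin n ] 𝟙< (wreathDist g x f v) (wreathDist g x (f [ v ]≔ h) v)
        ≡⟨ ∑-cong (allVecs m n) (λ g → ∑-cong (allFin n) (λ x → wreathDist-lampEdge g x f v h)) ⟩
      ∑[ g ∈ allVecs m n ] ∑[ _ ∈ allFin n ] F (lookup g v)
        ≡⟨ ∑-cong (allVecs m n) (λ g → trans (∑-const (allFin n) _) (cong (_* F (lookup g v)) (length-allFin n))) ⟩
      ∑[ g ∈ allVecs m n ] (n * F (lookup g v))
        ≡⟨ ∑-*ˡ (allVecs m n) n _ ⟩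
      n * ∑[ g ∈ allVecs m n ] F (lookup g v)
        ≡⟨ cong (n *_) (∑-allVecs-lookup m n v F) ⟩
      n * (m ^ (n ∸ 1) * ∑ (allFin m) F)
        ≡⟨ sym (*-assoc n _ _) ⟩
      n * m ^ (n ∸ 1) * ∑ (allFin m) F
        ≡⟨ cong (n * m ^ (n ∸ 1) *_) (sym (nVert-H (lookup f v) h)) ⟩
      n * m ^ (n ∸ 1) * nVert (toFinGraph H) (lookup f v) h ∎
    where
    open ≡-Reasoning
    F : Fin m → ℕ
    F y = 𝟙< (distH y (lookup f v)) (distH y h)

  nVert-lampEdge⁻ : ∀ f v h → nVert (wreath G H) (f [ v ]≔ h , v) (f , v) ≡ n * m ^ (n ∸ 1) * nVert (toFinGraph H) h (lookup f v)
  nVert-lampEdge⁻ f v h = begin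
      nVert (wreath G H) (f [ v ]≔ h , v) (f , v)
        ≡⟨ cong (λ f′ → nVert (wreath G H) (f [ v ]≔ h , v) (f′ , v)) (sym restore) ⟩
      nVert (wreath G H) (f [ v ]≔ h , v) ((f [ v ]≔ h) [ v ]≔ lookup f v , v)
        ≡⟨ nVert-lampEdge (f [ v ]≔ h) v (lookup f v) ⟩
      n * m ^ (n ∸ 1) * nVert (toFinGraph H) (lookup (f [ v ]≔ h) v) (lookup f v)
        ≡⟨ cong (λ c → n * m ^ (n ∸ 1) * nVert (toFinGraph H) c (lookup f v)) (VecP.lookup∘update v f h) ⟩
      n * m ^ (n ∸ 1) * nVert (toFinGraph H) h (lookup f v) ∎
    where
    open ≡-Reasoning
    restore : (f [ v ]≔ h) [ v ]≔ lookup f v ≡ f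
    restore = trans (VecP.[]≔-idempotent f v) (VecP.[]≔-lookup f v)

  nVert-baseEdge : ∀ f v v′ → nVert (wreath G H) (f , v) (f , v′) ≡ ∑[ A ∈ allSubsets n ] ((m ∸ 1) ^ ∣ A ∣ * nρ G A v v′)
  nVert-baseEdge f v v′ = begin
      nVert (wreath G H) (f , v) (f , v′)
        ≡⟨ nVert-wreath f v f v′ ⟩
      ∑[ g ∈ allVecs m n ] ∑[ x ∈ allFin n ] 𝟙< (wreathDist g x f v) (wreathDist g x f v′)
        ≡⟨ ∑-cong (allVecs m n) (λ g → trans (∑-cong (allFin n) (λ x → cancelLamps g x)) (sym (nρ≡∑ (differ g f) v v′))) ⟩
      ∑[ g ∈ allVecs m n ] nρ G (differ g f) v v′
        ≡⟨ ∑-allVecs-differ f (λ A → nρ G A v v′) ⟩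
      ∑[ A ∈ allSubsets n ] ((m ∸ 1) ^ ∣ A ∣ * nρ G A v v′) ∎
    where
    open ≡-Reasoning
    cancelLamps : ∀ g x → 𝟙< (wreathDist g x f v) (wreathDist g x f v′) ≡ 𝟙< (ρ G (differ g f) x v) (ρ G (differ g f) x v′)
    cancelLamps g x = trans (cong₂ 𝟙< (+-comm (ρ G (differ g f) x v) _) (+-comm (ρ G (differ g f) x v′) _))
                            (𝟙<-+ˡ (lampDist g f) _ _)

  nVertH : Fin m → Fin m → ℕ
  nVertH = nVert (toFinGraph H)

  nVertW : Vec (Fin m) n × Fin n → Vec (Fin m) n × Fin n → ℕ
  nVertW = nVert (wreath G H)

  c : ℕ
  c = n * m ^ (n ∸ 1)

  lampEdgesAt baseEdgesAt : Vec (Fin m) n → Fin n → ℕ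
  lampEdgesAt f v = ∑[ h ∈ allFin m ] (𝟙 (Graph.adj H (lookup f v) h) * (nVertW (f , v) (f [ v ]≔ h , v) * nVertW (f [ v ]≔ h , v) (f , v)))
  baseEdgesAt f v = ∑[ v′ ∈ allFin n ] (𝟙 (Graph.adj G v v′) * (nVertW (f , v) (f , v′) * nVertW (f , v′) (f , v)))

  lampEdgesAt≡ : ∀ f v →
    lampEdgesAt f v ≡ c * c * ∑[ h ∈ allFin m ] (𝟙 (Graph.adj H (lookup f v) h) * (nVertH (lookup f v) h * nVertH h (lookup f v)))
  lampEdgesAt≡ f v = trans (∑-cong (allFin m) (λ h → trans
      (cong₂ (λ p q → 𝟙 (Graph.adj H (lookup f v) h) * (p * q)) (nVert-lampEdge f v h) (nVert-lampEdge⁻ f v h))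
      (reorder (𝟙 (Graph.adj H (lookup f v) h)) c (nVertH (lookup f v) h) (nVertH h (lookup f v)))))
    (∑-*ˡ (allFin m) (c * c) _)
    where
    reorder : ∀ i c a b → i * (c * a * (c * b)) ≡ c * c * (i * (a * b))
    reorder = solve-∀

  Sz-wreath-lamp : ∑[ f ∈ allVecs m n ] ∑[ v ∈ allFin n ] lampEdgesAt f v ≡ c * c * (n * (m ^ (n ∸ 1) * (2 * Sz (toFinGraph H))))
  Sz-wreath-lamp = begin
      _ ≡⟨ ∑-cong (allVecs m n) (λ f → trans (∑-cong (allFin n) (lampEdgesAt≡ f)) (∑-*ˡ (allFin n) (c * c) (λ v → Q (lookup f v)))) ⟩
      ∑[ f ∈ allVecs m n ] (c * c * ∑[ v ∈ allFin n ] Q (lookup f v)) ≡⟨ ∑-*ˡ (allVecs m n) (c * c) _ ⟩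
      c * c * ∑[ f ∈ allVecs m n ] ∑[ v ∈ allFin n ] Q (lookup f v)   ≡⟨ cong (c * c *_) (∑-comm (allVecs m n) (allFin n) _) ⟩
      c * c * ∑[ v ∈ allFin n ] ∑[ f ∈ allVecs m n ] Q (lookup f v)
        ≡⟨ cong (c * c *_) (∑-cong (allFin n) (λ v → ∑-allVecs-lookup m n v Q)) ⟩
      c * c * ∑[ _ ∈ allFin n ] (m ^ (n ∸ 1) * ∑ (allFin m) Q)
        ≡⟨ cong (c * c *_) (∑-const (allFin n) _) ⟩
      c * c * (length (allFin n) * (m ^ (n ∸ 1) * ∑ (allFin m) Q))
        ≡⟨ cong (λ l → c * c * (l * (m ^ (n ∸ 1) * ∑ (allFin m) Q))) (length-allFin n) ⟩
      c * c * (n * (m ^ (n ∸ 1) * ∑ (allFin m) Q))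
        ≡⟨ cong (λ s → c * c * (n * (m ^ (n ∸ 1) * s))) (sym (Sz-double (toFinGraph H) (Graph.sym H) (Graph.irrefl H))) ⟩
      c * c * (n * (m ^ (n ∸ 1) * (2 * Sz (toFinGraph H)))) ∎
    where
    open ≡-Reasoning
    Q : Fin m → ℕ
    Q a = ∑[ h ∈ allFin m ] (𝟙 (Graph.adj H a h) * (nVertH a h * nVertH h a))

  weight : Subset n → ℕ
  weight A = (m ∸ 1) ^ ∣ A ∣

  weightedNρ : Fin n → Fin n → ℕ
  weightedNρ v v′ = ∑[ A ∈ allSubsets n ] (weight A * nρ G A v v′)

  SzAB-double : ∀ A B → ∑[ v ∈ allFin n ] ∑[ v′ ∈ allFin n ] (𝟙 (Graph.adj G v v′) * (nρ G A v v′ * nρ G B v′ v)) ≡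
                        SzAB G A B + SzAB G B A
  SzAB-double A B = trans (∑∑-adj (allFin n) (Graph.adj G) (Graph.sym G) (Graph.irrefl G) _)
    (cong₂ _+_ (∑-cong Ps (λ (u , v) → refl))
               (∑-cong Ps (λ (u , v) → cong (if Graph.adj G u v then_else 0) (*-comm (nρ G A v u) _))))
    where
    Ps : List (Fin n × Fin n)
    Ps = orderedPairs (allFin n)

  ∑∑-weightedNρ : ∑[ v ∈ allFin n ] ∑[ v′ ∈ allFin n ] (𝟙 (Graph.adj G v v′) * (weightedNρ v v′ * weightedNρ v′ v)) ≡
                  2 * subsetSum G m
  ∑∑-weightedNρ = begin
      ∑[ v ∈ FN ] ∑[ v′ ∈ FN ] (𝟙 (Graph.adj G v v′) * (weightedNρ v v′ * weightedNρ v′ v))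
        ≡⟨ ∑-cong FN (λ v → ∑-cong FN (λ v′ → expand v v′)) ⟩
      ∑[ v ∈ FN ] ∑[ v′ ∈ FN ] ∑[ A ∈ SS ] ∑[ B ∈ SS ] (weight A * weight B * T A B v v′)
        ≡⟨ trans (∑-cong FN (λ v → ∑-comm FN SS _)) (∑-comm FN SS _) ⟩
      ∑[ A ∈ SS ] ∑[ v ∈ FN ] ∑[ v′ ∈ FN ] ∑[ B ∈ SS ] (weight A * weight B * T A B v v′)
        ≡⟨ ∑-cong SS (λ A → trans (∑-cong FN (λ v → ∑-comm FN SS _)) (∑-comm FN SS _)) ⟩
      ∑[ A ∈ SS ] ∑[ B ∈ SS ] ∑[ v ∈ FN ] ∑[ v′ ∈ FN ] (weight A * weight B * T A B v v′)
        ≡⟨ ∑-cong SS (λ A → ∑-cong SS (λ B → trans (∑-cong FN (λ v → ∑-*ˡ FN (weight A * weight B) _))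
                                                   (trans (∑-*ˡ FN (weight A * weight B) _) (cong (weight A * weight B *_) (SzAB-double A B))))) ⟩
      ∑[ A ∈ SS ] ∑[ B ∈ SS ] (weight A * weight B * (SzAB G A B + SzAB G B A))
        ≡⟨ ∑-cong SS (λ A → trans (∑-cong SS (λ B → *-distribˡ-+ (weight A * weight B) _ _)) (∑-+ SS _ _)) ⟩
      ∑[ A ∈ SS ] (∑[ B ∈ SS ] (weight A * weight B * SzAB G A B) + ∑[ B ∈ SS ] (weight A * weight B * SzAB G B A))
        ≡⟨ ∑-+ SS _ _ ⟩
      Total + ∑[ A ∈ SS ] ∑[ B ∈ SS ] (weight A * weight B * SzAB G B A)
        ≡⟨ cong (Total +_) (trans (∑-comm SS SS _)
                                  (∑-cong SS (λ B → ∑-cong SS (λ A → cong (_* SzAB G B A) (*-comm (weight A) (weight B)))))) ⟩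
      Total + Total
        ≡⟨ cong₂ _+_ Total≡subsetSum (trans Total≡subsetSum (sym (+-identityʳ _))) ⟩
      2 * subsetSum G m ∎
    where
    open ≡-Reasoning
    FN : List (Fin n)
    FN = allFin n
    SS : List (Subset n)
    SS = allSubsets n
    T : Subset n → Subset n → Fin n → Fin n → ℕ
    T A B v v′ = 𝟙 (Graph.adj G v v′) * (nρ G A v v′ * nρ G B v′ v)
    Total : ℕ
    Total = ∑[ A ∈ SS ] ∑[ B ∈ SS ] (weight A * weight B * SzAB G A B)
    regroup : ∀ i x a y b → i * (x * a * (y * b)) ≡ x * y * (i * (a * b))
    regroup = solve-∀
    expand : ∀ v v′ → 𝟙 (Graph.adj G v v′) * (weightedNρ v v′ * weightedNρ v′ v) ≡
                      ∑[ A ∈ SS ] ∑[ B ∈ SS ] (weight A * weight B * T A B v v′)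
    expand v v′ = begin
        𝟙 (Graph.adj G v v′) * (weightedNρ v v′ * weightedNρ v′ v)
          ≡⟨ cong (𝟙 (Graph.adj G v v′) *_) (∑-product SS SS _ _) ⟩
        𝟙 (Graph.adj G v v′) * ∑[ A ∈ SS ] ∑[ B ∈ SS ] (weight A * nρ G A v v′ * (weight B * nρ G B v′ v))
          ≡⟨ sym (∑-*ˡ SS i _) ⟩
        ∑[ A ∈ SS ] (i * ∑[ B ∈ SS ] (weight A * nρ G A v v′ * (weight B * nρ G B v′ v)))
          ≡⟨ ∑-cong SS (λ A → trans (sym (∑-*ˡ SS i _))
                                    (∑-cong SS (λ B → regroup i (weight A) (nρ G A v v′) (weight B) (nρ G B v′ v)))) ⟩
        ∑[ A ∈ SS ] ∑[ B ∈ SS ] (weight A * weight B * T A B v v′) ∎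
      where
      i : ℕ
      i = 𝟙 (Graph.adj G v v′)
    Total≡subsetSum : Total ≡ subsetSum G m
    Total≡subsetSum = ∑-cong SS (λ A → ∑-cong SS (λ B → cong (_* SzAB G A B) (sym (^-distribˡ-+-* (m ∸ 1) ∣ A ∣ ∣ B ∣))))

  Sz-wreath-base : ∑[ f ∈ allVecs m n ] ∑[ v ∈ allFin n ] baseEdgesAt f v ≡ m ^ n * (2 * subsetSum G m)
  Sz-wreath-base = begin
      _ ≡⟨ ∑-cong (allVecs m n) (λ f → ∑-cong (allFin n) (λ v → ∑-cong (allFin n) (λ v′ →
             cong₂ (λ p q → 𝟙 (Graph.adj G v v′) * (p * q)) (nVert-baseEdge f v v′) (nVert-baseEdge f v′ v)))) ⟩
      ∑[ _ ∈ allVecs m n ] ∑[ v ∈ allFin n ] ∑[ v′ ∈ allFin n ] (𝟙 (Graph.adj G v v′) * (weightedNρ v v′ * weightedNρ v′ v))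
        ≡⟨ ∑-const (allVecs m n) _ ⟩
      length (allVecs m n) * ∑[ v ∈ allFin n ] ∑[ v′ ∈ allFin n ] (𝟙 (Graph.adj G v v′) * (weightedNρ v v′ * weightedNρ v′ v))
        ≡⟨ cong₂ _*_ (length-allVecs m n) ∑∑-weightedNρ ⟩
      m ^ n * (2 * subsetSum G m) ∎
    where open ≡-Reasoning

  Sz-wreath-double : 2 * Sz (wreath G H) ≡ c * c * (n * (m ^ (n ∸ 1) * (2 * Sz (toFinGraph H)))) + m ^ n * (2 * subsetSum G m)
  Sz-wreath-double = begin
      2 * Sz (wreath G H)
        ≡⟨ Sz-double (wreath G H) wadj-sym wadj-irrefl ⟩
      ∑[ a ∈ wreathVerts ] ∑[ b ∈ wreathVerts ] (𝟙 (wadj a b) * (nVertW a b * nVertW b a))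
        ≡⟨ ∑-wreathVerts _ ⟩
      ∑[ f ∈ allVecs m n ] ∑[ v ∈ allFin n ] ∑[ b ∈ wreathVerts ] (𝟙 (wadj (f , v) b) * (nVertW (f , v) b * nVertW b (f , v)))
        ≡⟨ ∑-cong (allVecs m n) (λ f → trans (∑-cong (allFin n) (λ v → ∑-neighbours f v (λ b → nVertW (f , v) b * nVertW b (f , v))))
                                             (∑-+ (allFin n) _ _)) ⟩
      ∑[ f ∈ allVecs m n ] (∑[ v ∈ allFin n ] lampEdgesAt f v + ∑[ v ∈ allFin n ] baseEdgesAt f v)
        ≡⟨ ∑-+ (allVecs m n) _ _ ⟩
      ∑[ f ∈ allVecs m n ] ∑[ v ∈ allFin n ] lampEdgesAt f v + ∑[ f ∈ allVecs m n ] ∑[ v ∈ allFin n ] baseEdgesAt f v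
        ≡⟨ cong₂ _+_ Sz-wreath-lamp Sz-wreath-base ⟩
      c * c * (n * (m ^ (n ∸ 1) * (2 * Sz (toFinGraph H)))) + m ^ n * (2 * subsetSum G m) ∎
    where open ≡-Reasoning

m^[3n∸3]≡[m^[n∸1]]^3 : ∀ m n → m ^ (3 * n ∸ 3) ≡ (m ^ (n ∸ 1)) ^ 3
m^[3n∸3]≡[m^[n∸1]]^3 m n =
  trans (cong (m ^_) (trans (sym (*-distribˡ-∸ 3 n 1)) (*-comm 3 (n ∸ 1)))) (sym (^-*-assoc m (n ∸ 1) 3))

theorem6p12 : {n m : ℕ} (G : Graph n) (H : Graph m) → Connected G → Connected H →
    Sz (wreath G H) ≡ n ^ 3 * m ^ (3 * n ∸ 3) * Sz (toFinGraph H) + m ^ n * subsetSum G m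
theorem6p12 {n} {m} G H connectedG connectedH = *-cancelˡ-≡ _ _ 2 (begin
    2 * Sz (wreath G H)
      ≡⟨ Sz-wreath-double ⟩
    n * M * (n * M) * (n * (M * (2 * Sz (toFinGraph H)))) + m ^ n * (2 * subsetSum G m)
      ≡⟨ regroup n M (Sz (toFinGraph H)) (m ^ n) (subsetSum G m) ⟩
    2 * (n ^ 3 * M ^ 3 * Sz (toFinGraph H) + m ^ n * subsetSum G m)
      ≡⟨ cong (λ e → 2 * (n ^ 3 * e * Sz (toFinGraph H) + m ^ n * subsetSum G m)) (sym (m^[3n∸3]≡[m^[n∸1]]^3 m n)) ⟩
    2 * (n ^ 3 * m ^ (3 * n ∸ 3) * Sz (toFinGraph H) + m ^ n * subsetSum G m) ∎)
  where
  open ≡-Reasoning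
  open Wreath G H connectedG connectedH using (Sz-wreath-double)
  M : ℕ
  M = m ^ (n ∸ 1)
  regroup : ∀ a b s p q → a * b * (a * b) * (a * (b * (2 * s))) + p * (2 * q) ≡
                          2 * (a * (a * (a * 1)) * (b * (b * (b * 1))) * s + p * q)
  regroup = solve-∀
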